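{- Let $\mathcal{W}$ be the downward closure of the widdershins spirals. Every permutation $\pi\in\mathcal{W}$ can be expressed either as one of $1\oplus\alpha$, $\alpha\oplus 1$, $1\ominus\alpha$, $\alpha\ominus 1$ for some $\alpha\in\mathcal{W}$, or as the central insertion into a widdershins spiral of length at least $4$ of a (possibly empty) permutation $\alpha\in\mathcal{W}$.
   Context: Permutations are identified with their plots $\{(i,\pi(i))\}$, and more generally with finite generic point sets in the plane (no two points share an $x$- or $y$-coordinate), up to order-isomorphism. A permutation $\sigma$ is contained in $\pi$ if some subset of the plot of $\pi$ is order-isomorphic to the plot of $\sigma$. For $\pi$ of length $k$ and $\sigma$ of length $\ell$: $(\pi\oplus\sigma)(i)=\pi(i)$ for $i\le k$ and $\sigma(i-k)+k$ for $k<i\le k+\ell$; $(\pi\ominus\sigma)(i)=\pi(i)+\ell$ for $i\le k$ and $\sigma(i-k)$ for $k<i\le k+\ell$; $1$ denotes the permutation of length one. The rectangular hull of a finite point set is the smallest axis-parallel rectangle containing it. Given points $p_1,\dots,p_i$, a proper pin for $(p_1,\dots,p_i)$ is a point $p$ lying outside the rectangular hull $R$ of $\{p_1,\dots,p_i\}$ that lies horizontally or vertically between $p_i$ and the rectangular hull of $\{p_1,\dots,p_{i-1}\}$; it is called a left, right, up, or down pin according as it lies to the left of, right of, above, or below $R$. A widdershins spiral of standard orientation is (the permutation of) a generic point sequence $p_1,\dots,p_k$ with $k\ge 4$ such that $p_2$ lies above and to the left of $p_1$, each $p_{i+1}$ ($i\ge 2$) is a proper pin for $(p_1,\dots,p_i)$,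 and the directions of $p_3,p_4,p_5,\dots$ form an initial segment of the repeating pattern left, down, right, up, left, down, right, up, $\dots$. A widdershins spiral is a widdershins spiral of standard orientation or its rotation by $90^\circ$, $180^\circ$ or $270^\circ$; its length is its number of points. $\mathcal{W}$ is the set of all permutations contained in some widdershins spiral. Central insertion: for a widdershins spiral of standard orientation $p_1,\dots,p_k$, let $O$ be a point whose $x$-coordinate lies strictly between those of $p_4$ and $p_2$ and whose $y$-coordinate lies strictly between those of $p_1$ and $p_3$ (no point of the spiral has a coordinate in these ranges). The central insertion of $\alpha$ into the spiral is the permutation whose plot consists of the points of the spiral together with a copy of the plot of $\alpha$ placed inside a sufficiently small axis-parallel square centred at $O$ (so the entries of $\alpha$ form an interval of the result). Central insertion into rotated spirals is defined by the corresponding rotation. -}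

module Defs where

open import Data.Nat as ℕ using (ℕ; zero; suc)
open import Data.Integer as ℤ using (ℤ; -_; _⊓_; _⊔_)
open import Data.Fin using (Fin)
open import Data.List using (List; []; _∷_; _++_; map; length; lookup; upTo; foldr)
open import Data.List.Relation.Unary.All using (All)
open import Data.List.Relation.Unary.AllPairs using (AllPairs)
open import Data.List.Relation.Binary.Permutation.Propositional using (_↭_)
open import Data.Product using (Σ; ∃; _×_; _,_; proj₁; proj₂)
open import Data.Sum using (_⊎_)
open import Function.Bundles using (_⇔_)
open import Relation.Binary.PropositionalEquality using (_≡_; _≢_)

-- Permutations: one-line notation with values 0 … n-1 (0-based).

IsPerm : List ℕ → Set
IsPerm π = π ↭ upTo (length π)

one : List ℕ
one = 0 ∷ []

infixl 6 _⊕_ _⊖_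

_⊕_ : List ℕ → List ℕ → List ℕ
π ⊕ σ = π ++ map (λ v → v ℕ.+ length π) σ

_⊖_ : List ℕ → List ℕ → List ℕ
π ⊖ σ = map (λ v → v ℕ.+ length σ) π ++ σ

Contained : List ℕ → List ℕ → Set
Contained σ π =
  Σ (Fin (length σ) → Fin (length π)) λ g →
    (∀ i j → i Data.Fin.< j → g i Data.Fin.< g j) ×
    (∀ i j → (lookup σ i ℕ.< lookup σ j) ⇔ (lookup π (g i) ℕ.< lookup π (g j)))

-- Points in the plane (integer coordinates suffice up to order-isomorphism)

Point : Set
Point = ℤ × ℤ

X Y : Point → ℤ
X = proj₁
Y = proj₂

Generic : List Point → Set
Generic = AllPairs (λ p q → X p ≢ X q × Y p ≢ Y q)

-- π is the permutation of the (generic) point sequence P: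
-- P is order-isomorphic to the plot {(i, π(i))} of π.
PlotOf : List ℕ → List Point → Set
PlotOf π P =
  Generic P × length P ≡ length π ×
  Σ (Fin (length P) → Fin (length π)) λ h →
    ∀ i j → ((X (lookup P i) ℤ.< X (lookup P j)) ⇔ (h i Data.Fin.< h j)) ×
            ((Y (lookup P i) ℤ.< Y (lookup P j)) ⇔ (lookup π (h i) ℕ.< lookup π (h j)))

minX maxX minY maxY : Point → List Point → ℤ
minX q qs = foldr (λ p m → X p ⊓ m) (X q) qs
maxX q qs = foldr (λ p m → X p ⊔ m) (X q) qs
minY q qs = foldr (λ p m → Y p ⊓ m) (Y q) qs
maxY q qs = foldr (λ p m → Y p ⊔ m) (Y q) qs

data Dir : Set where
  left down right up : Dir

dirOf : ℕ → Dir
dirOf 0 = left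
dirOf 1 = down
dirOf 2 = right
dirOf 3 = up
dirOf (suc (suc (suc (suc n)))) = dirOf n

VBetween : Point → List Point → Point → Point → Set
VBetween q qs l p = (maxY q qs ℤ.< Y p × Y p ℤ.< Y l) ⊎ (Y l ℤ.< Y p × Y p ℤ.< minY q qs)

HBetween : Point → List Point → Point → Point → Set
HBetween q qs l p = (maxX q qs ℤ.< X p × X p ℤ.< X l) ⊎ (X l ℤ.< X p × X p ℤ.< minX q qs)

-- p is a proper pin of direction d for the sequence (q ∷ qs) ++ [ l ]
-- (l is the last point p_i; q ∷ qs are p_1 … p_{i-1}; R is the hull of all).
ProperPin : Dir → Point → List Point → Point → Point → Set
ProperPin left  q qs l p = X p ℤ.< minX q (qs ++ l ∷ []) × VBetween q qs l p
ProperPin right q qs l p = maxX q (qs ++ l ∷ []) ℤ.< X p × VBetween q qs l p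
ProperPin down  q qs l p = Y p ℤ.< minY q (qs ++ l ∷ []) × HBetween q qs l p
ProperPin up    q qs l p = maxY q (qs ++ l ∷ []) ℤ.< Y p × HBetween q qs l p

Standard : List Point → Set
Standard P =
  Σ Point λ p₁ → Σ Point λ p₂ → Σ Point λ p₃ → Σ Point λ p₄ → Σ (List Point) λ rest →
    P ≡ p₁ ∷ p₂ ∷ p₃ ∷ p₄ ∷ rest ×
    Generic P ×
    (X p₂ ℤ.< X p₁ × Y p₁ ℤ.< Y p₂) ×
    (∀ q qs l p rest′ → P ≡ (q ∷ qs) ++ l ∷ p ∷ rest′ →
       ProperPin (dirOf (length qs)) q qs l p)

rot : Point → Point
rot (x , y) = (- y , x)

rotN : ℕ → Point → Point
rotN zero p = p
rotN (suc r) p = rot (rotN r p)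

Widdershins : List Point → Set
Widdershins P = Σ ℕ λ r → Σ (List Point) λ S → Standard S × P ≡ map (rotN r) S

InW : List ℕ → Set
InW π = IsPerm π × Σ (List Point) λ P → Σ (List ℕ) λ σ →
          Widdershins P × PlotOf σ P × Contained π σ

InBox : List Point → Point → Set
InBox S a =
  Σ Point λ p₁ → Σ Point λ p₂ → Σ Point λ p₃ → Σ Point λ p₄ → Σ (List Point) λ rest →
    S ≡ p₁ ∷ p₂ ∷ p₃ ∷ p₄ ∷ rest ×
    (X p₄ ℤ.< X a × X a ℤ.< X p₂) × (Y p₁ ℤ.< Y a × Y a ℤ.< Y p₃)

CentralInsertion : List ℕ → List ℕ → Set
CentralInsertion α π =
  Σ ℕ λ r → Σ (List Point) λ S → Σ (List Point) λ A →
    Standard S × All (InBox S) A ×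
    PlotOf α (map (rotN r) A) ×
    PlotOf π (map (rotN r) (S ++ A))

module Submission where

-- Realise π as a pattern in a standard spiral S = s₀ s₁ … (viewed after r quarter
-- turns), let m be the largest index of S used by π and e ≤ m the start of the
-- maximal block e, e+1, …, m of used indices, so that e - 1 is unused.
--
-- * Short block (m < e + 3): s_e lies beyond every other used point both in the
--   direction of its own pin and in the preceding direction.  A point extreme in
--   two consecutive directions is the first or last entry and the least or
--   greatest value of π, so π is a sum of 1 and the pattern α of the rest.
-- * Long block: s_e … s_m, turned back by e quarter turns, is a standard spiral of
--   length ≥ 4, and every other used point has index < e - 1 and so lies in its
--   central box: π is the central insertion of the pattern α of those points.

open import Defs
open import Data.Nat as ℕ using (ℕ; zero; suc; z≤n; s≤s; pred; _∸_)
import Data.Nat.Properties as ℕP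
open import Data.Nat.Solver using (module +-*-Solver)
open import Data.Integer as ℤ using (ℤ; 0ℤ)
import Data.Integer.Properties as ℤP
open import Data.Fin as Fin using (Fin; zero; suc; toℕ; fromℕ<)
import Data.Fin.Properties as FinP
open import Data.List
  using (List; []; _∷_; _++_; map; length; lookup; upTo; applyUpTo; filter; allFin; _∷ʳ_; initLast; _∷ʳ′_)
open import Data.List.Properties using (length-map; length-++; length-++-sucʳ; length-applyUpTo; upTo-∷ʳ)
open import Data.List.Relation.Unary.All as All using (All; []; _∷_)
import Data.List.Relation.Unary.All.Properties as AllP
open import Data.List.Relation.Unary.AllPairs as AllPairs using (AllPairs; []; _∷_)
import Data.List.Relation.Unary.AllPairs.Properties as AllPairsP
open import Data.List.Relation.Unary.Any using (here; there)
open import Data.List.Relation.Unary.Unique.Propositional using (Unique)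
import Data.List.Relation.Unary.Unique.Propositional.Properties as UniqueP
open import Data.List.Membership.Propositional using (_∈_)
open import Data.List.Membership.Propositional.Properties
  using (∈-lookup; ∈-∃++; ∈-upTo⁺; ∈-++⁻; ∈-filter⁺; ∈-filter⁻; ∈-allFin)
open import Data.List.Membership.DecPropositional ℕP._≟_ using (_∈?_)
open import Data.List.Relation.Binary.Permutation.Propositional as ↭ using (_↭_; ↭-sym)
open import Data.List.Relation.Binary.Permutation.Propositional.Properties using (All-resp-↭; ∈-resp-↭; shift; ∷↭∷ʳ)
import Data.List.Relation.Binary.Permutation.Setoid.Properties as ↭ₛ
open import Data.Product using (Σ; ∃; _×_; _,_; proj₁; proj₂)
open import Data.Sum using (_⊎_; inj₁; inj₂)
open import Data.Empty using (⊥; ⊥-elim)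
open import Function.Bundles using (_⇔_; mk⇔; Equivalence)
import Function.Properties.Equivalence as ⇔
open import Relation.Binary.PropositionalEquality
open import Relation.Binary.Definitions using (tri<; tri≈; tri>)
open import Relation.Nullary using (¬_; Dec; yes; no)

open Equivalence using (to; from)

private variable
  A B : Set

-- Positional access with a default value, indexed by natural numbers: spiral
-- positions are manipulated arithmetically, so ℕ-indices are more convenient
-- than Fin-indices here.
nth : A → List A → ℕ → A
nth d [] _ = d
nth d (x ∷ xs) zero = x
nth d (x ∷ xs) (suc k) = nth d xs k

nth-∈ : ∀ (d : A) xs p → p ℕ.< length xs → nth d xs p ∈ xs
nth-∈ d (x ∷ xs) zero _ = here refl
nth-∈ d (x ∷ xs) (suc p) (s≤s lt) = there (nth-∈ d xs p lt)

nth-All : ∀ {P : A → Set} (d : A) {xs} → All P xs → ∀ p → p ℕ.< length xs → P (nth d xs p)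
nth-All d (h ∷ hs) zero _ = h
nth-All d (h ∷ hs) (suc p) (s≤s lt) = nth-All d hs p lt

All-nth : ∀ {P : A → Set} (d : A) xs → (∀ p → p ℕ.< length xs → P (nth d xs p)) → All P xs
All-nth d [] f = []
All-nth d (x ∷ xs) f = f 0 (s≤s z≤n) ∷ All-nth d xs (λ p lt → f (suc p) (s≤s lt))

AllPairs-nth : ∀ {R : A → A → Set} (d : A) xs →
  (∀ p q → p ℕ.< q → q ℕ.< length xs → R (nth d xs p) (nth d xs q)) → AllPairs R xs
AllPairs-nth d [] f = []
AllPairs-nth d (x ∷ xs) f =
  All-nth d xs (λ q lt → f 0 (suc q) (s≤s z≤n) (s≤s lt)) ∷
  AllPairs-nth d xs (λ p q p<q q< → f (suc p) (suc q) (s≤s p<q) (s≤s q<))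

nth-AllPairs : ∀ {R : A → A → Set} (d : A) {xs} → AllPairs R xs →
  ∀ p q → p ℕ.< q → q ℕ.< length xs → R (nth d xs p) (nth d xs q)
nth-AllPairs d (h ∷ hs) zero (suc q) _ (s≤s lt) = nth-All d h q lt
nth-AllPairs d (h ∷ hs) (suc p) (suc q) (s≤s p<q) (s≤s q<) = nth-AllPairs d hs p q p<q q<

nth-index : ∀ (d : A) {x xs} → x ∈ xs → Σ ℕ λ p → p ℕ.< length xs × nth d xs p ≡ x
nth-index d (here refl) = 0 , s≤s z≤n , refl
nth-index d (there m) with nth-index d m
... | p , lt , eq = suc p , s≤s lt , eq

nth-map : ∀ (f : A → B) d d′ xs p → p ℕ.< length xs → nth d′ (map f xs) p ≡ f (nth d xs p)
nth-map f d d′ (x ∷ xs) zero _ = refl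
nth-map f d d′ (x ∷ xs) (suc p) (s≤s lt) = nth-map f d d′ xs p lt

nth-++ˡ : ∀ (d : A) ys zs p → p ℕ.< length ys → nth d (ys ++ zs) p ≡ nth d ys p
nth-++ˡ d (y ∷ ys) zs zero _ = refl
nth-++ˡ d (y ∷ ys) zs (suc p) (s≤s lt) = nth-++ˡ d ys zs p lt

nth-++ʳ : ∀ (d : A) ys zs p → nth d (ys ++ zs) (length ys ℕ.+ p) ≡ nth d zs p
nth-++ʳ d [] zs p = refl
nth-++ʳ d (y ∷ ys) zs p = nth-++ʳ d ys zs p

nth-applyUpTo : ∀ (d : A) f n p → p ℕ.< n → nth d (applyUpTo f n) p ≡ f p
nth-applyUpTo d f (suc n) zero _ = refl
nth-applyUpTo d f (suc n) (suc p) (s≤s lt) = nth-applyUpTo d (λ i → f (suc i)) n p lt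

lookup-nth : ∀ (d : A) xs k → lookup xs k ≡ nth d xs (toℕ k)
lookup-nth d (x ∷ xs) zero = refl
lookup-nth d (x ∷ xs) (suc k) = lookup-nth d xs k

monotone-reflects : ∀ {n m} (g : Fin n → Fin m) → (∀ i j → i Fin.< j → g i Fin.< g j) →
  ∀ i j → g i Fin.< g j → i Fin.< j
monotone-reflects g inc i j lt with FinP.<-cmp i j
... | tri< i<j _ _ = i<j
... | tri≈ _ refl _ = ⊥-elim (ℕP.<-irrefl refl lt)
... | tri> _ _ j<i = ⊥-elim (ℕP.<-asym lt (inc j i j<i))

monotone-injective : ∀ {n m} (g : Fin n → Fin m) → (∀ i j → i Fin.< j → g i Fin.< g j) →
  ∀ i j → g i ≡ g j → i ≡ j
monotone-injective g inc i j eq with FinP.<-cmp i j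
... | tri< i<j _ _ = ⊥-elim (ℕP.<-irrefl (cong toℕ eq) (inc i j i<j))
... | tri≈ _ i≡j _ = i≡j
... | tri> _ _ j<i = ⊥-elim (ℕP.<-irrefl (cong toℕ (sym eq)) (inc j i j<i))

Beyond : Dir → Point → Point → Set
Beyond left  p q = X p ℤ.< X q
Beyond right p q = X q ℤ.< X p
Beyond down  p q = Y p ℤ.< Y q
Beyond up    p q = Y q ℤ.< Y p

nextD prevD opp : Dir → Dir
nextD left = down
nextD down = right
nextD right = up
nextD up = left
prevD left = up
prevD down = left
prevD right = down
prevD up = right
opp left = right
opp down = up
opp right = left
opp up = down

turn : ℕ → Dir → Dir
turn zero d = d
turn (suc s) d = nextD (turn s d)

prev-next : ∀ d → prevD (nextD d) ≡ d
prev-next left = refl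
prev-next down = refl
prev-next right = refl
prev-next up = refl

opp-next : ∀ d → opp (nextD d) ≡ prevD d
opp-next left = refl
opp-next down = refl
opp-next right = refl
opp-next up = refl

opp-next-next : ∀ d → opp (nextD (nextD d)) ≡ d
opp-next-next left = refl
opp-next-next down = refl
opp-next-next right = refl
opp-next-next up = refl

turn-prev : ∀ s d → turn s (prevD d) ≡ prevD (turn s d)
turn-prev zero d = refl
turn-prev (suc s) d rewrite turn-prev s d = next-prev (turn s d)
  where
  next-prev : ∀ d → nextD (prevD d) ≡ prevD (nextD d)
  next-prev left = refl
  next-prev down = refl
  next-prev right = refl
  next-prev up = refl

turn-opp : ∀ s d → turn s (opp d) ≡ opp (turn s d)
turn-opp zero d = refl
turn-opp (suc s) d rewrite turn-opp s d = next-opp (turn s d)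
  where
  next-opp : ∀ d → nextD (opp d) ≡ opp (nextD d)
  next-opp left = refl
  next-opp down = refl
  next-opp right = refl
  next-opp up = refl

dirOf-suc : ∀ n → dirOf (suc n) ≡ nextD (dirOf n)
dirOf-suc 0 = refl
dirOf-suc 1 = refl
dirOf-suc 2 = refl
dirOf-suc 3 = refl
dirOf-suc (suc (suc (suc (suc n)))) = dirOf-suc n

turn-dirOf : ∀ s n → turn s (dirOf n) ≡ dirOf (s ℕ.+ n)
turn-dirOf zero n = refl
turn-dirOf (suc s) n rewrite turn-dirOf s n = sym (dirOf-suc (s ℕ.+ n))

dirOf-periodic : ∀ K n → dirOf (K ℕ.* 4 ℕ.+ n) ≡ dirOf n
dirOf-periodic zero n = refl
dirOf-periodic (suc K) n = dirOf-periodic K n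

Beyond-resp : ∀ {d d′ p q} → d ≡ d′ → Beyond d p q → Beyond d′ p q
Beyond-resp refl h = h

Beyond-opp : ∀ d p q → Beyond d p q → Beyond (opp d) q p
Beyond-opp left p q h = h
Beyond-opp down p q h = h
Beyond-opp right p q h = h
Beyond-opp up p q h = h

Beyond-opp⁻ : ∀ d p q → Beyond (opp d) p q → Beyond d q p
Beyond-opp⁻ left p q h = h
Beyond-opp⁻ down p q h = h
Beyond-opp⁻ right p q h = h
Beyond-opp⁻ up p q h = h

rot-Beyond : ∀ d p q → Beyond d p q → Beyond (nextD d) (rot p) (rot q)
rot-Beyond left p q h = h
rot-Beyond down p q h = ℤP.neg-mono-< h
rot-Beyond right p q h = h
rot-Beyond up p q h = ℤP.neg-mono-< h

rotN-Beyond : ∀ s d p q → Beyond d p q → Beyond (turn s d) (rotN s p) (rotN s q)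
rotN-Beyond zero d p q h = h
rotN-Beyond (suc s) d p q h = rot-Beyond (turn s d) (rotN s p) (rotN s q) (rotN-Beyond s d p q h)

rotN-+ : ∀ a b p → rotN a (rotN b p) ≡ rotN (a ℕ.+ b) p
rotN-+ zero b p = refl
rotN-+ (suc a) b p = cong rot (rotN-+ a b p)

rotN-periodic : ∀ K p → rotN (K ℕ.* 4) p ≡ p
rotN-periodic zero p = refl
rotN-periodic (suc K) p = trans (rot⁴ (rotN (K ℕ.* 4) p)) (rotN-periodic K p)
  where
  rot⁴ : ∀ p → rot (rot (rot (rot p))) ≡ p
  rot⁴ (x , y) = cong₂ _,_ (ℤP.neg-involutive x) (ℤP.neg-involutive y)

minF maxF : (Point → ℤ) → Point → List Point → ℤ
minF f q xs = Data.List.foldr (λ p m → f p ℤ.⊓ m) (f q) xs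
maxF f q xs = Data.List.foldr (λ p m → f p ℤ.⊔ m) (f q) xs

<minF⁻ : ∀ f z q xs → z ℤ.< minF f q xs → All (λ p → z ℤ.< f p) (q ∷ xs)
<minF⁻ f z q [] h = h ∷ []
<minF⁻ f z q (x ∷ xs) h with <minF⁻ f z q xs (ℤP.<-≤-trans h (ℤP.i⊓j≤j (f x) _))
... | hq ∷ hs = hq ∷ ℤP.<-≤-trans h (ℤP.i⊓j≤i (f x) _) ∷ hs

<minF⁺ : ∀ f z q xs → All (λ p → z ℤ.< f p) (q ∷ xs) → z ℤ.< minF f q xs
<minF⁺ f z q [] (h ∷ []) = h
<minF⁺ f z q (x ∷ xs) (hq ∷ hx ∷ hs) with ℤP.⊓-sel (f x) (minF f q xs)
... | inj₁ e rewrite e = hx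
... | inj₂ e rewrite e = <minF⁺ f z q xs (hq ∷ hs)

maxF<⁻ : ∀ f z q xs → maxF f q xs ℤ.< z → All (λ p → f p ℤ.< z) (q ∷ xs)
maxF<⁻ f z q [] h = h ∷ []
maxF<⁻ f z q (x ∷ xs) h with maxF<⁻ f z q xs (ℤP.≤-<-trans (ℤP.i≤j⊔i (f x) _) h)
... | hq ∷ hs = hq ∷ ℤP.≤-<-trans (ℤP.i≤i⊔j (f x) _) h ∷ hs

maxF<⁺ : ∀ f z q xs → All (λ p → f p ℤ.< z) (q ∷ xs) → maxF f q xs ℤ.< z
maxF<⁺ f z q [] (h ∷ []) = h
maxF<⁺ f z q (x ∷ xs) (hq ∷ hx ∷ hs) with ℤP.⊔-sel (f x) (maxF f q xs)
... | inj₁ e rewrite e = hx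
... | inj₂ e rewrite e = maxF<⁺ f z q xs (hq ∷ hs)

All-snoc⁻ : ∀ {P : Point → Set} q qs l → All P (q ∷ (qs ++ l ∷ [])) → All P (q ∷ qs) × P l
All-snoc⁻ q qs l (h ∷ hs) with AllP.++⁻ qs hs
... | hqs , (hl ∷ []) = (h ∷ hqs) , hl

All-snoc⁺ : ∀ {P : Point → Set} q qs l → All P (q ∷ qs) → P l → All P (q ∷ (qs ++ l ∷ []))
All-snoc⁺ q qs l (h ∷ hs) hl = h ∷ AllP.++⁺ hs (hl ∷ [])

-- A pin p of direction d for p₁ … pᵢ₋₁, l
-- lies beyond all of them in direction d; if l lies beyond p₁ … pᵢ₋₁ in the
-- previous direction (as it does in a spiral), then p lies beyond p₁ … pᵢ₋₁ in
-- that direction too, while l lies beyond p in it.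

pin-ahead : ∀ d q qs l p → ProperPin d q qs l p → All (Beyond d p) (q ∷ qs) × Beyond d p l
pin-ahead left q qs l p (h , _) = All-snoc⁻ q qs l (<minF⁻ X _ q _ h)
pin-ahead right q qs l p (h , _) = All-snoc⁻ q qs l (maxF<⁻ X _ q _ h)
pin-ahead down q qs l p (h , _) = All-snoc⁻ q qs l (<minF⁻ Y _ q _ h)
pin-ahead up q qs l p (h , _) = All-snoc⁻ q qs l (maxF<⁻ Y _ q _ h)

pin-between : ∀ d q qs l p → All (Beyond (prevD d) l) (q ∷ qs) → ProperPin d q qs l p →
  All (Beyond (prevD d) p) (q ∷ qs) × Beyond (opp (prevD d)) p l
pin-between left q qs l p (hl ∷ _) (_ , inj₁ (a , b)) = maxF<⁻ Y _ q qs a , b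
pin-between left q qs l p (hl ∷ _) (_ , inj₂ (a , b)) =
  ⊥-elim (ℤP.<-asym hl (ℤP.<-trans a (All.head (<minF⁻ Y _ q qs b))))
pin-between down q qs l p (hl ∷ _) (_ , inj₁ (a , b)) =
  ⊥-elim (ℤP.<-asym hl (ℤP.<-trans (All.head (maxF<⁻ X _ q qs a)) b))
pin-between down q qs l p (hl ∷ _) (_ , inj₂ (a , b)) = <minF⁻ X _ q qs b , a
pin-between right q qs l p (hl ∷ _) (_ , inj₁ (a , b)) =
  ⊥-elim (ℤP.<-asym hl (ℤP.<-trans (All.head (maxF<⁻ Y _ q qs a)) b))
pin-between right q qs l p (hl ∷ _) (_ , inj₂ (a , b)) = <minF⁻ Y _ q qs b , a
pin-between up q qs l p (hl ∷ _) (_ , inj₁ (a , b)) = maxF<⁻ X _ q qs a , b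
pin-between up q qs l p (hl ∷ _) (_ , inj₂ (a , b)) =
  ⊥-elim (ℤP.<-asym hl (ℤP.<-trans a (All.head (<minF⁻ X _ q qs b))))

pin-intro : ∀ d q qs l p → All (Beyond d p) (q ∷ qs) → Beyond d p l →
  All (Beyond (prevD d) p) (q ∷ qs) → Beyond (opp (prevD d)) p l → ProperPin d q qs l p
pin-intro left q qs l p h₁ h₂ h₃ h₄ =
  <minF⁺ X _ q _ (All-snoc⁺ q qs l h₁ h₂) , inj₁ (maxF<⁺ Y _ q qs h₃ , h₄)
pin-intro right q qs l p h₁ h₂ h₃ h₄ =
  maxF<⁺ X _ q _ (All-snoc⁺ q qs l h₁ h₂) , inj₂ (h₄ , <minF⁺ Y _ q qs h₃)
pin-intro down q qs l p h₁ h₂ h₃ h₄ =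
  <minF⁺ Y _ q _ (All-snoc⁺ q qs l h₁ h₂) , inj₂ (h₄ , <minF⁺ X _ q qs h₃)
pin-intro up q qs l p h₁ h₂ h₃ h₄ =
  maxF<⁺ Y _ q _ (All-snoc⁺ q qs l h₁ h₂) , inj₁ (maxF<⁺ X _ q qs h₃ , h₄)

-- In a standard spiral s₀ s₁ s₂ …, the point s_b
-- (b ≥ 1) is placed in direction pinDir b, so it lies beyond every earlier point
-- in that direction; perpendicularly it lies beyond the points before s_{b-1} in
-- the previous pin direction, and beyond s_{b-1} in the opposite one.  This
-- "spiral order" is equivalent to the pin conditions and, unlike them, is
-- evidently preserved by rotations and by passing to segments.

at : List Point → ℕ → Point
at = nth (0ℤ , 0ℤ)

pinDir : ℕ → Dir
pinDir b = dirOf (2 ℕ.+ b)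

Across : ℕ → ℕ → Point → Point → Set
Across a b pa pb =
  (suc a ℕ.< b × Beyond (prevD (pinDir b)) pb pa) ⊎ (suc a ≡ b × Beyond (opp (prevD (pinDir b))) pb pa)

SpiralPair : ℕ → ℕ → Point → Point → Set
SpiralPair a b pa pb = Beyond (pinDir b) pb pa × Across a b pa pb

SpiralOrdered : List Point → Set
SpiralOrdered S = ∀ a b → a ℕ.< b → b ℕ.< length S → SpiralPair a b (at S a) (at S b)

prefix-split : ∀ S c → 2 ℕ.+ c ℕ.< length S →
  Σ Point λ q → Σ (List Point) λ qs → Σ (List Point) λ rest →
    S ≡ (q ∷ qs) ++ at S (suc c) ∷ at S (2 ℕ.+ c) ∷ rest × length qs ≡ c ×
    (∀ a → a ℕ.≤ c → at S a ≡ at (q ∷ qs) a)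
prefix-split (s₀ ∷ s₁ ∷ s₂ ∷ rest) zero _ = s₀ , [] , rest , refl , refl , λ { .zero z≤n → refl }
prefix-split (s₀ ∷ s₁ ∷ []) zero (s≤s (s≤s ()))
prefix-split (s₀ ∷ S) (suc c) (s≤s lt) with prefix-split S c lt
... | q , qs , rest , eq , len , agree =
  s₀ , q ∷ qs , rest , cong (s₀ ∷_) eq , cong suc len ,
  λ { zero _ → refl ; (suc a) (s≤s le) → agree a le }

prefix-positions : ∀ S q qs l p rest → S ≡ (q ∷ qs) ++ l ∷ p ∷ rest →
  (2 ℕ.+ length qs ℕ.< length S) × at S (suc (length qs)) ≡ l × at S (2 ℕ.+ length qs) ≡ p ×
  (∀ a → a ℕ.≤ length qs → at S a ≡ at (q ∷ qs) a)
prefix-positions S q qs l p rest refl =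
  bound q qs ,
  subst (λ k → at S k ≡ l) (ℕP.+-identityʳ (suc (length qs))) (nth-++ʳ _ (q ∷ qs) (l ∷ p ∷ rest) 0) ,
  subst (λ k → at S k ≡ p) (ℕP.+-comm (suc (length qs)) 1) (nth-++ʳ _ (q ∷ qs) (l ∷ p ∷ rest) 1) ,
  λ a le → nth-++ˡ _ (q ∷ qs) (l ∷ p ∷ rest) a (s≤s le)
  where
  bound : ∀ q qs → 2 ℕ.+ length qs ℕ.< length ((q ∷ qs) ++ l ∷ p ∷ rest)
  bound q [] = s≤s (s≤s (s≤s z≤n))
  bound q (q′ ∷ qs) = s≤s (bound q′ qs)

module StandardIsOrdered (S : List Point) (p₁ p₂ p₃ p₄ : Point) (rest : List Point)
  (S≡ : S ≡ p₁ ∷ p₂ ∷ p₃ ∷ p₄ ∷ rest)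
  (p₂-left : X p₂ ℤ.< X p₁) (p₂-above : Y p₁ ℤ.< Y p₂)
  (pins : ∀ q qs l p rest′ → S ≡ (q ∷ qs) ++ l ∷ p ∷ rest′ → ProperPin (dirOf (length qs)) q qs l p) where

  pinAt : ∀ c → (lt : 2 ℕ.+ c ℕ.< length S) → let (q , qs , _) = prefix-split S c lt in
          ProperPin (dirOf c) q qs (at S (suc c)) (at S (2 ℕ.+ c))
  pinAt c lt with prefix-split S c lt
  ... | q , qs , rest , eqS , len , _ =
    subst (λ n → ProperPin (dirOf n) q qs (at S (suc c)) (at S (2 ℕ.+ c))) len (pins q qs _ _ rest eqS)

  ahead : ∀ c a → a ℕ.≤ suc c → 2 ℕ.+ c ℕ.< length S → Beyond (dirOf c) (at S (2 ℕ.+ c)) (at S a)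
  ahead c a le lt with prefix-split S c lt | pinAt c lt
  ... | q , qs , rest , eqS , len , agree | pin with pin-ahead (dirOf c) q qs _ _ pin
  ... | before , last with ℕP.m≤n⇒m<n∨m≡n le
  ... | inj₂ refl = last
  ... | inj₁ (s≤s a≤c) rewrite agree a a≤c = nth-All _ before a (s≤s (subst (a ℕ.≤_) (sym len) a≤c))

  previous : ∀ c a → a ℕ.≤ c → 2 ℕ.+ c ℕ.< length S → Beyond (prevD (dirOf c)) (at S (suc c)) (at S a)
  previous zero .zero z≤n lt rewrite S≡ = p₂-above
  previous (suc c) a le lt rewrite dirOf-suc c | prev-next (dirOf c) =
    ahead c a le (ℕP.<-trans (ℕP.n<1+n _) lt)

  ordered : SpiralOrdered S
  ordered a zero () _
  ordered .zero (suc zero) (s≤s z≤n) lt rewrite S≡ = p₂-above , inj₂ (refl , p₂-left)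
  ordered a (suc (suc c)) (s≤s a≤) lt with prefix-split S c lt | pinAt c lt
  ... | q , qs , rest , eqS , len , agree | pin =
    ahead c a a≤ lt , perpendicular (ℕP.m≤n⇒m<n∨m≡n a≤)
    where
    l-previous : All (Beyond (prevD (dirOf c)) (at S (suc c))) (q ∷ qs)
    l-previous = All-nth _ (q ∷ qs) λ a′ a′< →
      let a′≤ = subst (a′ ℕ.≤_) len (ℕP.≤-pred a′<) in
      subst (Beyond (prevD (dirOf c)) (at S (suc c))) (agree a′ a′≤) (previous c a′ a′≤ lt)
    between : All (Beyond (prevD (dirOf c)) (at S (2 ℕ.+ c))) (q ∷ qs) ×
              Beyond (opp (prevD (dirOf c))) (at S (2 ℕ.+ c)) (at S (suc c))
    between = pin-between (dirOf c) q qs _ _ l-previous pin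
    perpendicular : a ℕ.< suc c ⊎ a ≡ suc c → Across a (2 ℕ.+ c) (at S a) (at S (2 ℕ.+ c))
    perpendicular (inj₂ refl) = inj₂ (refl , proj₂ between)
    perpendicular (inj₁ (s≤s a≤c)) rewrite agree a a≤c =
      inj₁ (s≤s (s≤s a≤c) , nth-All _ (proj₁ between) a (s≤s (subst (a ℕ.≤_) (sym len) a≤c)))

standard⇒ordered : ∀ S → Standard S → SpiralOrdered S
standard⇒ordered S (p₁ , p₂ , p₃ , p₄ , rest , S≡ , _ , (p₂-left , p₂-above) , pins) =
  StandardIsOrdered.ordered S p₁ p₂ p₃ p₄ rest S≡ p₂-left p₂-above pins

>⇒≢ : ∀ {a b : ℤ} → b ℤ.< a → a ≢ b
>⇒≢ h eq = ℤP.<⇒≢ h (sym eq)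

SpiralPair⇒distinct : ∀ a b pa pb → SpiralPair a b pa pb → X pa ≢ X pb × Y pa ≢ Y pb
SpiralPair⇒distinct a b pa pb (h , inj₁ (_ , k)) = distinct-prev (pinDir b) h k
  where
  distinct-prev : ∀ d → Beyond d pb pa → Beyond (prevD d) pb pa → X pa ≢ X pb × Y pa ≢ Y pb
  distinct-prev left h k = >⇒≢ h , ℤP.<⇒≢ k
  distinct-prev down h k = >⇒≢ k , >⇒≢ h
  distinct-prev right h k = ℤP.<⇒≢ h , >⇒≢ k
  distinct-prev up h k = ℤP.<⇒≢ k , ℤP.<⇒≢ h
SpiralPair⇒distinct a b pa pb (h , inj₂ (_ , k)) = distinct-next (pinDir b) h k
  where
  distinct-next : ∀ d → Beyond d pb pa → Beyond (opp (prevD d)) pb pa → X pa ≢ X pb × Y pa ≢ Y pb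
  distinct-next left h k = >⇒≢ h , >⇒≢ k
  distinct-next down h k = ℤP.<⇒≢ k , >⇒≢ h
  distinct-next right h k = ℤP.<⇒≢ h , ℤP.<⇒≢ k
  distinct-next up h k = >⇒≢ k , ℤP.<⇒≢ h

ordered⇒standard : ∀ S → SpiralOrdered S → 3 ℕ.< length S → Standard S
ordered⇒standard (_ ∷ []) ord (s≤s ())
ordered⇒standard (_ ∷ _ ∷ []) ord (s≤s (s≤s ()))
ordered⇒standard (_ ∷ _ ∷ _ ∷ []) ord (s≤s (s≤s (s≤s ())))
ordered⇒standard (p₁ ∷ p₂ ∷ p₃ ∷ p₄ ∷ rest) ord _ =
  p₁ , p₂ , p₃ , p₄ , rest , refl ,
  AllPairs-nth _ S (λ a b a<b b< → SpiralPair⇒distinct a b _ _ (ord a b a<b b<)) ,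
  start (ord 0 1 (s≤s z≤n) (s≤s (s≤s z≤n))) , pins
  where
  S : List Point
  S = p₁ ∷ p₂ ∷ p₃ ∷ p₄ ∷ rest
  start : SpiralPair 0 1 p₁ p₂ → X p₂ ℤ.< X p₁ × Y p₁ ℤ.< Y p₂
  start (_ , inj₁ (s≤s () , _))
  start (above , inj₂ (_ , left-of)) = left-of , above
  pins : ∀ q qs l p rest′ → S ≡ (q ∷ qs) ++ l ∷ p ∷ rest′ → ProperPin (dirOf (length qs)) q qs l p
  pins q qs l p rest′ eq with prefix-positions S q qs l p rest′ eq
  ... | lt , at-l , at-p , agree =
    pin-intro (dirOf c) q qs l p
      (All-nth _ (q ∷ qs) λ a a< → subst₂ (Beyond (dirOf c)) at-p (agree a (ℕP.≤-pred a<))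
         (proj₁ (pair a (ℕP.m≤n⇒m≤1+n (ℕP.≤-pred a<)))))
      (subst₂ (Beyond (dirOf c)) at-p at-l (proj₁ (pair (suc c) ℕP.≤-refl)))
      (All-nth _ (q ∷ qs) λ a a< → subst₂ (Beyond (prevD (dirOf c))) at-p (agree a (ℕP.≤-pred a<))
         (earlier a (ℕP.≤-pred a<) (proj₂ (pair a (ℕP.m≤n⇒m≤1+n (ℕP.≤-pred a<))))))
      (subst₂ (Beyond (opp (prevD (dirOf c)))) at-p at-l (adjacent (proj₂ (pair (suc c) ℕP.≤-refl))))
    where
    c : ℕ
    c = length qs
    pair : ∀ a → a ℕ.≤ suc c → SpiralPair a (2 ℕ.+ c) (at S a) (at S (2 ℕ.+ c))
    pair a le = ord a (2 ℕ.+ c) (s≤s le) lt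
    earlier : ∀ a → a ℕ.≤ c → Across a (2 ℕ.+ c) (at S a) (at S (2 ℕ.+ c)) → Beyond (prevD (dirOf c)) (at S (2 ℕ.+ c)) (at S a)
    earlier a le (inj₁ (_ , h)) = h
    earlier a le (inj₂ (e , _)) = ⊥-elim (ℕP.<-irrefl refl (subst (ℕ._≤ c) (ℕP.suc-injective e) le))
    adjacent : Across (suc c) (2 ℕ.+ c) (at S (suc c)) (at S (2 ℕ.+ c)) → Beyond (opp (prevD (dirOf c))) (at S (2 ℕ.+ c)) (at S (suc c))
    adjacent (inj₁ (lt′ , _)) = ⊥-elim (ℕP.<-irrefl refl lt′)
    adjacent (inj₂ (_ , h)) = h

-- The points s_e, s_{e+1}, …, s_{e+d-1} of a spiral,
-- rotated by 3e quarter turns (i.e. back by e), are again in spiral order, since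
-- the pin direction of s_{e+j} turned back by e quarter turns is that of s_j.

module Segment (S : List Point) (ord : SpiralOrdered S) (e : ℕ) where
  open +-*-Solver

  back : ℕ
  back = e ℕ.* 3

  turn-back : ∀ j → turn back (pinDir (e ℕ.+ j)) ≡ pinDir j
  turn-back j = begin
    turn back (pinDir (e ℕ.+ j))        ≡⟨ turn-dirOf back (2 ℕ.+ (e ℕ.+ j)) ⟩
    dirOf (back ℕ.+ (2 ℕ.+ (e ℕ.+ j)))  ≡⟨ cong dirOf (solve 2 (λ e j → e :* con 3 :+ (con 2 :+ (e :+ j))
                                              := e :* con 4 :+ (con 2 :+ j)) refl e j) ⟩
    dirOf (e ℕ.* 4 ℕ.+ (2 ℕ.+ j))      ≡⟨ dirOf-periodic e (2 ℕ.+ j) ⟩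
    pinDir j                            ∎
    where open ≡-Reasoning

  turned : ∀ {d d′} p q → turn back d ≡ d′ → Beyond d p q → Beyond d′ (rotN back p) (rotN back q)
  turned {d} p q refl h = rotN-Beyond back d p q h

  point : ℕ → Point
  point j = rotN back (at S (e ℕ.+ j))

  segment : ℕ → List Point
  segment d = applyUpTo point d

  segment-ordered : ∀ d → e ℕ.+ d ℕ.≤ length S → SpiralOrdered (segment d)
  segment-ordered d le a b a<b b<
    rewrite length-applyUpTo point d
          | nth-applyUpTo (0ℤ , 0ℤ) point d a (ℕP.<-trans a<b b<)
          | nth-applyUpTo (0ℤ , 0ℤ) point d b b<
    with ord (e ℕ.+ a) (e ℕ.+ b) (ℕP.+-monoʳ-< e a<b) (ℕP.<-≤-trans (ℕP.+-monoʳ-< e b<) le)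
  ... | ahead , across = turned _ _ (turn-back b) ahead , turn-across across
    where
    prev-back : turn back (prevD (pinDir (e ℕ.+ b))) ≡ prevD (pinDir b)
    prev-back = trans (turn-prev back _) (cong prevD (turn-back b))
    turn-across : Across (e ℕ.+ a) (e ℕ.+ b) (at S (e ℕ.+ a)) (at S (e ℕ.+ b)) → Across a b (point a) (point b)
    turn-across (inj₁ (lt , h)) =
      inj₁ (ℕP.+-cancelˡ-< e (suc a) b (subst (ℕ._< e ℕ.+ b) (sym (ℕP.+-suc e a)) lt) , turned _ _ prev-back h)
    turn-across (inj₂ (eq , h)) =
      inj₂ (ℕP.+-cancelˡ-≡ e (suc a) b (trans (ℕP.+-suc e a) eq) ,
            turned _ _ (trans (turn-opp back _) (cong opp prev-back)) h)

  segment-standard : ∀ d → e ℕ.+ suc (suc (suc (suc d))) ℕ.≤ length S → Standard (segment (suc (suc (suc (suc d)))))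
  segment-standard d le =
    ordered⇒standard _ (segment-ordered _ le)
      (subst (3 ℕ.<_) (sym (length-applyUpTo point (suc (suc (suc (suc d)))))) (s≤s (s≤s (s≤s (s≤s z≤n)))))

  -- s_b is not adjacent to s_{e+j}, so the latter lies beyond it in the previous pin direction
  beyond-early : ∀ b j → suc b ℕ.< e → e ℕ.+ j ℕ.< length S →
    Beyond (prevD (pinDir j)) (point j) (rotN back (at S b))
  beyond-early b j sb<e ej< with ord b (e ℕ.+ j) (ℕP.<-≤-trans (ℕP.<-trans (ℕP.n<1+n b) sb<e) (ℕP.m≤m+n e j)) ej<
  ... | _ , inj₁ (_ , h) = turned _ _ (trans (turn-prev back _) (cong prevD (turn-back j))) h
  ... | _ , inj₂ (eq , _) = ⊥-elim (ℕP.<-irrefl eq (ℕP.<-≤-trans sb<e (ℕP.m≤m+n e j)))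

  early-in-box : ∀ d b → e ℕ.+ suc (suc (suc (suc d))) ℕ.≤ length S → suc b ℕ.< e →
    InBox (segment (suc (suc (suc (suc d))))) (rotN back (at S b))
  early-in-box d b le sb<e =
    point 0 , point 1 , point 2 , point 3 , _ , refl ,
    (beyond-early b 3 sb<e (inS 3 (s≤s (s≤s (s≤s (s≤s z≤n))))) , beyond-early b 1 sb<e (inS 1 (s≤s (s≤s z≤n)))) ,
    (beyond-early b 0 sb<e (inS 0 (s≤s z≤n)) , beyond-early b 2 sb<e (inS 2 (s≤s (s≤s (s≤s z≤n)))))
    where
    inS : ∀ j → j ℕ.< suc (suc (suc (suc d))) → e ℕ.+ j ℕ.< length S
    inS j j< = ℕP.<-≤-trans (ℕP.+-monoʳ-< e j<) le

-- The point s_e lies beyond s_x both in its own pin direction and in the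
-- previous one whenever x ≤ e - 2 or x ∈ {e+1, e+2}: the next two pins do not reach
-- past s_e in those two directions (only s_{e-1} and s_{e+3} onwards can).

pinDir-suc : ∀ e → pinDir (suc e) ≡ nextD (pinDir e)
pinDir-suc e = dirOf-suc (2 ℕ.+ e)

pinDir-suc² : ∀ e → pinDir (suc (suc e)) ≡ nextD (nextD (pinDir e))
pinDir-suc² e = trans (pinDir-suc (suc e)) (cong nextD (pinDir-suc e))

corner : ∀ S → SpiralOrdered S → ∀ e x → e ℕ.< length S → x ℕ.< length S →
  (suc (suc x) ℕ.≤ e ⊎ x ≡ suc e ⊎ x ≡ suc (suc e)) →
  Beyond (pinDir e) (at S e) (at S x) × Beyond (prevD (pinDir e)) (at S e) (at S x)
corner S ord e x e< x< (inj₁ le) with ord x e (ℕP.<-trans (ℕP.n<1+n x) le) e<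
... | ahead , inj₁ (_ , h) = ahead , h
... | ahead , inj₂ (eq , _) = ⊥-elim (ℕP.<-irrefl eq le)
corner S ord e .(suc e) e< x< (inj₂ (inj₁ refl)) with ord e (suc e) ℕP.≤-refl x<
... | _ , inj₁ (lt , _) = ⊥-elim (ℕP.<-irrefl refl lt)
... | ahead , inj₂ (_ , h) =
  Beyond-opp⁻ (pinDir e) _ _ (Beyond-resp (cong opp prev-suc) h) ,
  Beyond-resp (trans (cong opp (pinDir-suc e)) (opp-next (pinDir e))) (Beyond-opp _ _ _ ahead)
  where
  prev-suc : prevD (pinDir (suc e)) ≡ pinDir e
  prev-suc = trans (cong prevD (pinDir-suc e)) (prev-next (pinDir e))
corner S ord e .(suc (suc e)) e< x< (inj₂ (inj₂ refl)) with ord e (suc (suc e)) (ℕP.<-trans (ℕP.n<1+n e) (ℕP.n<1+n _)) x<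
... | _ , inj₂ (eq , _) = ⊥-elim (ℕP.<-irrefl (ℕP.suc-injective eq) (ℕP.n<1+n _))
... | ahead , inj₁ (_ , h) =
  Beyond-resp (trans (cong opp (pinDir-suc² e)) (opp-next-next (pinDir e))) (Beyond-opp _ _ _ ahead) ,
  Beyond-resp opp-prev-suc² (Beyond-opp _ _ _ h)
  where
  opp-prev-suc² : opp (prevD (pinDir (suc (suc e)))) ≡ prevD (pinDir e)
  opp-prev-suc² = trans (cong (λ d → opp (prevD d)) (pinDir-suc² e))
                        (trans (cong opp (prev-next _)) (opp-next (pinDir e)))

-- Permutations.  A list is a permutation iff its entries are distinct and
-- smaller than its length (the ⇐ direction is a pigeonhole argument).

lookup-injective : ∀ {xs : List ℕ} → Unique xs → ∀ i j → lookup xs i ≡ lookup xs j → i ≡ j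
lookup-injective (x∉ ∷ u) zero zero _ = refl
lookup-injective (x∉ ∷ u) zero (suc j) eq = ⊥-elim (All.lookup x∉ (∈-lookup j) eq)
lookup-injective (x∉ ∷ u) (suc i) zero eq = ⊥-elim (All.lookup x∉ (∈-lookup i) (sym eq))
lookup-injective (x∉ ∷ u) (suc i) (suc j) eq = cong suc (lookup-injective u i j eq)

Unique-resp-↭ : ∀ {xs ys : List ℕ} → xs ↭ ys → Unique xs → Unique ys
Unique-resp-↭ p = ↭ₛ.Unique-resp-↭ (setoid ℕ) (↭.↭⇒↭ₛ p)

pigeonhole : ∀ {k xs} → Unique xs → All (ℕ._< k) xs → length xs ℕ.≤ k
pigeonhole {k} {xs} u bounded = FinP.injective⇒≤ {f = slot} λ {i} {j} eq →
  lookup-injective u i j (trans (sym (FinP.toℕ-fromℕ< _)) (trans (cong toℕ eq) (FinP.toℕ-fromℕ< _)))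
  where
  slot : Fin (length xs) → Fin k
  slot i = fromℕ< (All.lookup bounded (∈-lookup i))

unique-bounded⇒↭ : ∀ n xs → length xs ≡ n → Unique xs → All (ℕ._< n) xs → xs ↭ upTo n
unique-bounded⇒↭ zero [] _ _ _ = ↭.refl
unique-bounded⇒↭ (suc n) xs len u bounded with n ∈? xs
... | no n∉xs = ⊥-elim (ℕP.<-irrefl refl (subst (ℕ._≤ n) len (pigeonhole u below-n)))
  where
  below-n : All (ℕ._< n) xs
  below-n = All.tabulate λ {y} y∈xs →
    ℕP.≤∧≢⇒< (ℕP.≤-pred (All.lookup bounded y∈xs)) (λ y≡n → n∉xs (subst (_∈ xs) y≡n y∈xs))
... | yes n∈xs with ∈-∃++ n∈xs
... | ys , zs , refl = begin
  ys ++ n ∷ zs     ↭⟨ shift n ys zs ⟩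
  n ∷ (ys ++ zs)   ↭⟨ ↭.prep n (unique-bounded⇒↭ n (ys ++ zs) len′ (AllPairs.tail u′) below-n) ⟩
  n ∷ upTo n       ↭⟨ ∷↭∷ʳ n (upTo n) ⟩
  upTo n ∷ʳ n      ≡⟨ upTo-∷ʳ n ⟩
  upTo (suc n)     ∎
  where
  open ↭.PermutationReasoning
  u′ : Unique (n ∷ ys ++ zs)
  u′ = Unique-resp-↭ (shift n ys zs) u
  len′ : length (ys ++ zs) ≡ n
  len′ = ℕP.suc-injective (trans (sym (length-++-sucʳ ys n zs)) len)
  below-n : All (ℕ._< n) (ys ++ zs)
  below-n = All.zipWith (λ (y< , n≢y) → ℕP.≤∧≢⇒< (ℕP.≤-pred y<) (λ y≡n → n≢y (sym y≡n)))
    (All.tail (All-resp-↭ (shift n ys zs) bounded) , AllPairs.head u′)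

IsPerm⇒unique : ∀ {π} → IsPerm π → Unique π
IsPerm⇒unique {π} p = Unique-resp-↭ (↭-sym p) (UniqueP.upTo⁺ (length π))

IsPerm⇒bounded : ∀ {π} → IsPerm π → All (ℕ._< length π) π
IsPerm⇒bounded {π} p = All-resp-↭ (↭-sym p) (AllP.applyUpTo⁺₁ (λ i → i) (length π) (λ lt → lt))

IsPerm-intro : ∀ {π} → Unique π → All (ℕ._< length π) π → IsPerm π
IsPerm-intro {π} u bounded = unique-bounded⇒↭ (length π) π refl u bounded

Contained-trans : ∀ α β γ → Contained α β → Contained β γ → Contained α γ
Contained-trans α β γ (g₁ , mono₁ , iff₁) (g₂ , mono₂ , iff₂) =
  (λ i → g₂ (g₁ i)) , (λ i j lt → mono₂ _ _ (mono₁ i j lt)) , λ i j → ⇔.trans (iff₁ i j) (iff₂ (g₁ i) (g₁ j))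

InW-closed : ∀ {π} α → InW π → IsPerm α → Contained α π → InW α
InW-closed {π} α (_ , P , σ , spiral , plot , π⊆σ) isPerm α⊆π =
  isPerm , P , σ , spiral , plot , Contained-trans α π σ α⊆π π⊆σ

Contained-refl : ∀ α → Contained α α
Contained-refl α = (λ i → i) , (λ i j lt → lt) , λ i j → ⇔.refl

Contained-∷ : ∀ α β x → Contained α β → Contained α (x ∷ β)
Contained-∷ α β x (g , mono , iff) = (λ i → suc (g i)) , (λ i j lt → s≤s (mono i j lt)) , iff

inject-++ : ∀ (ys zs : List A) → Fin (length ys) → Fin (length (ys ++ zs))
inject-++ (y ∷ ys) zs zero = zero
inject-++ (y ∷ ys) zs (suc i) = suc (inject-++ ys zs i)

lookup-inject-++ : ∀ (ys zs : List A) i → lookup (ys ++ zs) (inject-++ ys zs i) ≡ lookup ys i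
lookup-inject-++ (y ∷ ys) zs zero = refl
lookup-inject-++ (y ∷ ys) zs (suc i) = lookup-inject-++ ys zs i

toℕ-inject-++ : ∀ (ys zs : List A) i → toℕ (inject-++ ys zs i) ≡ toℕ i
toℕ-inject-++ (y ∷ ys) zs zero = refl
toℕ-inject-++ (y ∷ ys) zs (suc i) = cong suc (toℕ-inject-++ ys zs i)

inject-++-monotone : ∀ (ys zs : List A) i j → i Fin.< j → inject-++ ys zs i Fin.< inject-++ ys zs j
inject-++-monotone ys zs i j = subst₂ ℕ._<_ (sym (toℕ-inject-++ ys zs i)) (sym (toℕ-inject-++ ys zs j))

Contained-∷ʳ : ∀ α β x → Contained α β → Contained α (β ∷ʳ x)
Contained-∷ʳ α β x (g , mono , iff) =
  (λ i → inject-++ β (x ∷ []) (g i)) ,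
  (λ i j lt → inject-++-monotone β (x ∷ []) _ _ (mono i j lt)) ,
  λ i j → subst₂ (λ a b → _ ⇔ (a ℕ.< b)) (sym (lookup-inject-++ β _ (g i))) (sym (lookup-inject-++ β _ (g j))) (iff i j)

inject-map : ∀ (f : A → B) xs → Fin (length xs) → Fin (length (map f xs))
inject-map f (x ∷ xs) zero = zero
inject-map f (x ∷ xs) (suc i) = suc (inject-map f xs i)

lookup-inject-map : ∀ (f : A → B) xs i → lookup (map f xs) (inject-map f xs i) ≡ f (lookup xs i)
lookup-inject-map f (x ∷ xs) zero = refl
lookup-inject-map f (x ∷ xs) (suc i) = lookup-inject-map f xs i

inject-map-monotone : ∀ (f : A → B) xs i j → i Fin.< j → inject-map f xs i Fin.< inject-map f xs j
inject-map-monotone f (x ∷ xs) zero (suc j) _ = s≤s z≤n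
inject-map-monotone f (x ∷ xs) (suc i) (suc j) (s≤s lt) = s≤s (inject-map-monotone f xs i j lt)

Contained-shift : ∀ k α → Contained α (map (ℕ._+ k) α)
Contained-shift k α =
  inject-map (ℕ._+ k) α , inject-map-monotone (ℕ._+ k) α ,
  λ i j → subst₂ (λ a b → _ ⇔ (a ℕ.< b)) (sym (lookup-inject-map _ α i)) (sym (lookup-inject-map _ α j))
            (mk⇔ (ℕP.+-monoˡ-< k) (ℕP.+-cancelʳ-< k _ _))

SumWithOne : List ℕ → Set
SumWithOne π = Σ (List ℕ) λ α → InW α × (π ≡ one ⊕ α ⊎ π ≡ α ⊕ one ⊎ π ≡ one ⊖ α ⊎ π ≡ α ⊖ one)

unshift : ∀ {xs} → All (0 ℕ.<_) xs → map (ℕ._+ 1) (map pred xs) ≡ xs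
unshift [] = refl
unshift {suc x ∷ xs} (_ ∷ pos) = cong₂ _∷_ (ℕP.+-comm x 1) (unshift pos)

unshift-IsPerm : ∀ α → Unique (map (ℕ._+ 1) α) → All (ℕ._< suc (length α)) (map (ℕ._+ 1) α) → IsPerm α
unshift-IsPerm α u bounded =
  IsPerm-intro (UniqueP.map⁻ u) (All.map (λ {v} lt → ℕP.≤-pred (subst (ℕ._< suc (length α)) (ℕP.+-comm v 1) lt))
                                         (AllP.map⁻ bounded))

Unique-++⁻ˡ : ∀ (ys : List ℕ) {zs} → Unique (ys ++ zs) → Unique ys
Unique-++⁻ˡ [] u = []
Unique-++⁻ˡ (y ∷ ys) (y∉ ∷ u) = AllP.++⁻ˡ ys y∉ ∷ Unique-++⁻ˡ ys u

length-∷ʳ : ∀ (ys : List ℕ) x → length (ys ∷ʳ x) ≡ suc (length ys)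
length-∷ʳ ys x = trans (length-++ ys) (ℕP.+-comm (length ys) 1)

occurs : ∀ {π} → IsPerm π → ∀ v → v ℕ.< length π → v ∈ π
occurs p v v< = ∈-resp-↭ (↭-sym p) (∈-upTo⁺ v<)

first-least : ∀ x xs → InW (x ∷ xs) → All (x ℕ.<_) xs → SumWithOne (x ∷ xs)
first-least x xs w x<xs with occurs (proj₁ w) 0 (s≤s z≤n)
... | there 0∈xs = ⊥-elim (ℕP.n≮0 (All.lookup x<xs 0∈xs))
... | here refl = α , InW-closed _ w isPerm α⊆π , inj₁ (cong (0 ∷_) (sym (unshift x<xs)))
  where
  α : List ℕ
  α = map pred xs
  shifted : map (ℕ._+ 1) α ≡ xs
  shifted = unshift x<xs
  isPerm : IsPerm α
  isPerm = unshift-IsPerm α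
    (subst Unique (sym shifted) (AllPairs.tail (IsPerm⇒unique (proj₁ w))))
    (subst₂ (λ ys n → All (ℕ._< suc n) ys) (sym shifted) (sym (length-map pred xs)) (All.tail (IsPerm⇒bounded (proj₁ w))))
  α⊆π : Contained α (0 ∷ xs)
  α⊆π = subst (λ ys → Contained α (0 ∷ ys)) shifted (Contained-∷ α (map (ℕ._+ 1) α) 0 (Contained-shift 1 α))

first-greatest : ∀ x xs → InW (x ∷ xs) → All (ℕ._< x) xs → SumWithOne (x ∷ xs)
first-greatest x xs w xs<x with occurs (proj₁ w) (length xs) ℕP.≤-refl
... | there n∈xs = ⊥-elim (ℕP.<-irrefl refl (ℕP.<-≤-trans (All.lookup xs<x n∈xs) x≤n))
  where
  x≤n : x ℕ.≤ length xs
  x≤n = ℕP.≤-pred (All.head (IsPerm⇒bounded (proj₁ w)))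
... | here refl = xs , InW-closed _ w isPerm (Contained-∷ xs xs x (Contained-refl xs)) , inj₂ (inj₂ (inj₁ refl))
  where
  isPerm : IsPerm xs
  isPerm = IsPerm-intro (AllPairs.tail (IsPerm⇒unique (proj₁ w))) xs<x

last-least : ∀ ys x → InW (ys ∷ʳ x) → All (x ℕ.<_) ys → SumWithOne (ys ∷ʳ x)
last-least ys x w x<ys with ∈-++⁻ ys (occurs (proj₁ w) 0 (subst (0 ℕ.<_) (sym (length-∷ʳ ys x)) (s≤s z≤n)))
... | inj₁ 0∈ys = ⊥-elim (ℕP.n≮0 (All.lookup x<ys 0∈ys))
... | inj₂ (here refl) = α , InW-closed _ w isPerm α⊆π , inj₂ (inj₂ (inj₂ (cong (_∷ʳ 0) (sym shifted))))
  where
  α : List ℕ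
  α = map pred ys
  shifted : map (ℕ._+ 1) α ≡ ys
  shifted = unshift x<ys
  isPerm : IsPerm α
  isPerm = unshift-IsPerm α
    (subst Unique (sym shifted) (Unique-++⁻ˡ ys (IsPerm⇒unique (proj₁ w))))
    (subst₂ (λ zs n → All (ℕ._< n) zs) (sym shifted) (trans (length-∷ʳ ys 0) (cong suc (sym (length-map pred ys))))
      (AllP.++⁻ˡ ys (IsPerm⇒bounded (proj₁ w))))
  α⊆π : Contained α (ys ∷ʳ 0)
  α⊆π = subst (λ zs → Contained α (zs ∷ʳ 0)) shifted (Contained-∷ʳ α (map (ℕ._+ 1) α) 0 (Contained-shift 1 α))

last-greatest : ∀ ys x → InW (ys ∷ʳ x) → All (ℕ._< x) ys → SumWithOne (ys ∷ʳ x)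
last-greatest ys x w ys<x with ∈-++⁻ ys (occurs (proj₁ w) (length ys) (subst (length ys ℕ.<_) (sym (length-∷ʳ ys x)) ℕP.≤-refl))
... | inj₁ n∈ys = ⊥-elim (ℕP.<-irrefl refl (ℕP.<-≤-trans (All.lookup ys<x n∈ys) x≤n))
  where
  x≤n : x ℕ.≤ length ys
  x≤n = ℕP.≤-pred (subst (x ℕ.<_) (length-∷ʳ ys x) (All.head (AllP.++⁻ʳ ys (IsPerm⇒bounded (proj₁ w)))))
... | inj₂ (here refl) = ys , InW-closed _ w isPerm (Contained-∷ʳ ys ys x (Contained-refl ys)) , inj₂ (inj₁ refl)
  where
  isPerm : IsPerm ys
  isPerm = IsPerm-intro (Unique-++⁻ˡ ys (IsPerm⇒unique (proj₁ w))) ys<x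

injective⇒surjective : ∀ {m m′} → m′ ℕ.≤ m → (f : Fin m → Fin m′) → (∀ a b → f a ≡ f b → a ≡ b) →
  ∀ y → ∃ λ x → f x ≡ y
injective⇒surjective {m′ = suc _} le f inj y with FinP.any? (λ x → f x FinP.≟ y)
... | yes hit = hit
... | no miss = ⊥-elim (ℕP.<-irrefl refl (ℕP.<-≤-trans le (FinP.injective⇒≤ {f = avoid} λ {a} {b} eq →
                  inj a b (FinP.punchOut-injective (f≢y a) (f≢y b) eq))))
  where
  f≢y : ∀ x → y ≢ f x
  f≢y x eq = miss (x , sym eq)
  avoid : Fin _ → Fin _
  avoid x = Fin.punchOut (f≢y x)

record Realisation (π : List ℕ) : Set where
  field
    S : List Point
    r : ℕ
    standard : Standard S
    pos : Fin (length π) → ℕ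
    pos< : ∀ i → pos i ℕ.< length S
    pos-injective : ∀ i j → pos i ≡ pos j → i ≡ j
    x-order : ∀ i j → (X (rotN r (at S (pos i))) ℤ.< X (rotN r (at S (pos j)))) ⇔ (i Fin.< j)
    y-order : ∀ i j → (Y (rotN r (at S (pos i))) ℤ.< Y (rotN r (at S (pos j)))) ⇔ (lookup π i ℕ.< lookup π j)

realise : ∀ π → InW π → Realisation π
realise π (_ , .(map (rotN r) S) , σ , (r , S , standard , refl) , (generic , len , h , h-iso) , (g , g-mono , g-iff)) =
  record { S = S ; r = r ; standard = standard ; pos = pos ; pos< = pos<
         ; pos-injective = pos-injective ; x-order = x-order ; y-order = y-order }
  where
  P : List Point
  P = map (rotN r) S
  h-injective : ∀ a b → h a ≡ h b → a ≡ b
  h-injective a b eq with ℤP.<-cmp (X (lookup P a)) (X (lookup P b))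
  ... | tri< lt _ _ = ⊥-elim (ℕP.<-irrefl (cong toℕ eq) (to (proj₁ (h-iso a b)) lt))
  ... | tri> _ _ gt = ⊥-elim (ℕP.<-irrefl (cong toℕ (sym eq)) (to (proj₁ (h-iso b a)) gt))
  ... | tri≈ _ same-x _ = generic-x generic a b same-x
    where
    generic-x : ∀ {P} → Generic P → ∀ a b → X (lookup P a) ≡ X (lookup P b) → a ≡ b
    generic-x (_ ∷ gen) zero zero _ = refl
    generic-x (d ∷ gen) zero (suc b) eq = ⊥-elim (proj₁ (All.lookup d (∈-lookup b)) eq)
    generic-x (d ∷ gen) (suc a) zero eq = ⊥-elim (proj₁ (All.lookup d (∈-lookup a)) (sym eq))
    generic-x (_ ∷ gen) (suc a) (suc b) eq = cong suc (generic-x gen a b eq)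
  h⁻¹ : ∀ y → ∃ λ x → h x ≡ y
  h⁻¹ = injective⇒surjective (ℕP.≤-reflexive (sym len)) h h-injective
  w : Fin (length σ) → Fin (length P)
  w y = proj₁ (h⁻¹ y)
  hw : ∀ y → h (w y) ≡ y
  hw y = proj₂ (h⁻¹ y)
  pos : Fin (length π) → ℕ
  pos i = toℕ (w (g i))
  pos< : ∀ i → pos i ℕ.< length S
  pos< i = subst (pos i ℕ.<_) (length-map (rotN r) S) (FinP.toℕ<n (w (g i)))
  pos-injective : ∀ i j → pos i ≡ pos j → i ≡ j
  pos-injective i j eq = monotone-injective g g-mono i j
    (trans (sym (hw (g i))) (trans (cong h (FinP.toℕ-injective eq)) (hw (g j))))
  point≡ : ∀ i → lookup P (w (g i)) ≡ rotN r (at S (pos i))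
  point≡ i = trans (lookup-nth (0ℤ , 0ℤ) P (w (g i)))
                   (nth-map (rotN r) _ _ S (pos i) (pos< i))
  x-order : ∀ i j → (X (rotN r (at S (pos i))) ℤ.< X (rotN r (at S (pos j)))) ⇔ (i Fin.< j)
  x-order i j = subst₂ (λ a b → (X a ℤ.< X b) ⇔ (i Fin.< j)) (point≡ i) (point≡ j) (mk⇔
    (λ lt → monotone-reflects g g-mono i j (subst₂ Fin._<_ (hw (g i)) (hw (g j)) (to (proj₁ (h-iso _ _)) lt)))
    (λ lt → from (proj₁ (h-iso _ _)) (subst₂ Fin._<_ (sym (hw (g i))) (sym (hw (g j))) (g-mono i j lt))))
  y-order : ∀ i j → (Y (rotN r (at S (pos i))) ℤ.< Y (rotN r (at S (pos j)))) ⇔ (lookup π i ℕ.< lookup π j)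
  y-order i j = subst₂ (λ a b → (Y a ℤ.< Y b) ⇔ (lookup π i ℕ.< lookup π j)) (point≡ i) (point≡ j)
    (⇔.trans (proj₂ (h-iso _ _))
      (⇔.trans (subst₂ (λ a b → (lookup σ (h (w (g i))) ℕ.< lookup σ (h (w (g j)))) ⇔ (lookup σ a ℕ.< lookup σ b))
                 (hw (g i)) (hw (g j)) ⇔.refl)
        (⇔.sym (g-iff i j))))

All-lookup : ∀ {P : A → Set} xs → (∀ i → P (lookup xs i)) → All P xs
All-lookup [] f = []
All-lookup (x ∷ xs) f = f zero ∷ All-lookup xs (λ i → f (suc i))

last-index : ∀ (ys : List ℕ) x (i₀ : Fin (length (ys ∷ʳ x))) → (∀ j → j ≢ i₀ → j Fin.< i₀) → toℕ i₀ ≡ length ys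
last-index ys x i₀ above with fromℕ< (subst (length ys ℕ.<_) (sym (length-∷ʳ ys x)) ℕP.≤-refl) FinP.≟ i₀
... | yes eq = trans (cong toℕ (sym eq)) (FinP.toℕ-fromℕ< _)
... | no ne = ⊥-elim (ℕP.<-irrefl refl (ℕP.<-≤-trans
        (subst (ℕ._< toℕ i₀) (FinP.toℕ-fromℕ< _) (above _ ne))
        (ℕP.≤-pred (subst (toℕ i₀ ℕ.<_) (length-∷ʳ ys x) (FinP.toℕ<n i₀)))))

lookup-last : ∀ (ys : List ℕ) x (i : Fin (length (ys ∷ʳ x))) → toℕ i ≡ length ys → lookup (ys ∷ʳ x) i ≡ x
lookup-last [] x zero _ = refl
lookup-last (y ∷ ys) x (suc i) eq = lookup-last ys x i (ℕP.suc-injective eq)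

inject-not-last : ∀ (ys : List ℕ) x (i₀ : Fin (length (ys ∷ʳ x))) → toℕ i₀ ≡ length ys →
  ∀ k → inject-++ ys (x ∷ []) k ≢ i₀
inject-not-last ys x i₀ last k eq =
  ℕP.<-irrefl (trans (trans (sym (toℕ-inject-++ ys _ k)) (cong toℕ eq)) last) (FinP.toℕ<n k)

corner-entry : ∀ π → InW π → (F : Fin (length π) → Point) →
  (∀ i j → (X (F i) ℤ.< X (F j)) ⇔ (i Fin.< j)) →
  (∀ i j → (Y (F i) ℤ.< Y (F j)) ⇔ (lookup π i ℕ.< lookup π j)) →
  (i₀ : Fin (length π)) (D : Dir) →
  (∀ j → j ≢ i₀ → Beyond D (F i₀) (F j) × Beyond (prevD D) (F i₀) (F j)) → SumWithOne π
corner-entry (x ∷ xs) w F x-ord y-ord i₀ left extreme with i₀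
... | suc k = ⊥-elim (ℕP.n≮0 (to (x-ord (suc k) zero) (proj₁ (extreme zero (λ ())))))
... | zero = first-greatest x xs w (All-lookup xs λ k → to (y-ord (suc k) zero) (proj₂ (extreme (suc k) (λ ()))))
corner-entry (x ∷ xs) w F x-ord y-ord i₀ down extreme with i₀
... | suc k = ⊥-elim (ℕP.n≮0 (to (x-ord (suc k) zero) (proj₂ (extreme zero (λ ())))))
... | zero = first-least x xs w (All-lookup xs λ k → to (y-ord zero (suc k)) (proj₁ (extreme (suc k) (λ ()))))
corner-entry π w F x-ord y-ord i₀ right extreme with initLast π
... | ys ∷ʳ′ x = last-least ys x w (All-lookup ys λ k →
  subst₂ ℕ._<_ (lookup-last ys x i₀ last) (lookup-inject-++ ys _ k)
    (to (y-ord i₀ (inject-++ ys _ k)) (proj₂ (extreme _ (inject-not-last ys x i₀ last k)))))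
  where
  last : toℕ i₀ ≡ length ys
  last = last-index ys x i₀ (λ j ne → to (x-ord j i₀) (proj₁ (extreme j ne)))
corner-entry π w F x-ord y-ord i₀ up extreme with initLast π
... | ys ∷ʳ′ x = last-greatest ys x w (All-lookup ys λ k →
  subst₂ ℕ._<_ (lookup-inject-++ ys _ k) (lookup-last ys x i₀ last)
    (to (y-ord (inject-++ ys _ k) i₀) (proj₁ (extreme _ (inject-not-last ys x i₀ last k)))))
  where
  last : toℕ i₀ ≡ length ys
  last = last-index ys x i₀ (λ j ne → to (x-ord j i₀) (proj₂ (extreme j ne)))

argmax : ∀ {n} (f : Fin (suc n) → ℕ) → Σ (Fin (suc n)) λ i → ∀ j → f j ℕ.≤ f i
argmax {zero} f = zero , λ { zero → ℕP.≤-refl }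
argmax {suc n} f with argmax (λ j → f (suc j))
... | i , max with f zero ℕP.≤? f (suc i)
... | yes le = suc i , λ { zero → le ; (suc j) → max j }
... | no nle = zero , λ { zero → ℕP.≤-refl ; (suc j) → ℕP.≤-trans (max j) (ℕP.<⇒≤ (ℕP.≰⇒> nle)) }

module _ {n : ℕ} (t : Fin n → ℕ) where

  Used : ℕ → Set
  Used x = ∃ λ i → t i ≡ x

  Used? : ∀ x → Dec (Used x)
  Used? x = FinP.any? (λ i → t i ℕP.≟ x)

  MaximalBlock : ℕ → Set
  MaximalBlock m = Σ ℕ λ e → e ℕ.≤ m × (∀ x → e ℕ.≤ x → x ℕ.≤ m → Used x) × (∀ i → suc (t i) ≢ e)

  maximal-block : ∀ m k → k ℕ.≤ m → (∀ x → k ℕ.≤ x → x ℕ.≤ m → Used x) → MaximalBlock m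
  maximal-block m zero le used = zero , le , used , λ i ()
  maximal-block m (suc k) le used with Used? k
  ... | no unused = suc k , le , used , λ i eq → unused (i , ℕP.suc-injective eq)
  ... | yes k-used = maximal-block m k (ℕP.<⇒≤ le) used′
    where
    used′ : ∀ x → k ℕ.≤ x → x ℕ.≤ m → Used x
    used′ x k≤x x≤m with ℕP.m≤n⇒m<n∨m≡n k≤x
    ... | inj₁ k<x = used x k<x x≤m
    ... | inj₂ refl = k-used

record LastRun {π : List ℕ} (R : Realisation π) : Set where
  field
    m e : ℕ
    below-m : ∀ i → Realisation.pos R i ℕ.≤ m
    m< : m ℕ.< length (Realisation.S R)
    e≤m : e ℕ.≤ m
    block : ∀ x → e ℕ.≤ x → x ℕ.≤ m → Used (Realisation.pos R) x
    gap : ∀ i → suc (Realisation.pos R i) ≢ e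

last-run : ∀ {x xs} (R : Realisation (x ∷ xs)) → LastRun R
last-run {x} {xs} R = record
  { m = pos top ; e = proj₁ run ; below-m = proj₂ (argmax pos) ; m< = pos< top
  ; e≤m = proj₁ (proj₂ run) ; block = proj₁ (proj₂ (proj₂ run)) ; gap = proj₂ (proj₂ (proj₂ run)) }
  where
  open Realisation R
  top : Fin (length (x ∷ xs))
  top = proj₁ (argmax pos)
  run : MaximalBlock pos (pos top)
  run = maximal-block pos (pos top) (pos top) ℕP.≤-refl (λ x le ge → top , ℕP.≤-antisym le ge)

module ShortRun {π : List ℕ} (w : InW π) (R : Realisation π) (L : LastRun R)
  (short : LastRun.m L ℕ.< 3 ℕ.+ LastRun.e L) where
  open Realisation R
  open LastRun L

  placement : ∀ x → x ≢ e → suc x ≢ e → x ℕ.< 3 ℕ.+ e → (suc (suc x) ℕ.≤ e ⊎ x ≡ suc e ⊎ x ≡ suc (suc e))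
  placement x x≢e sx≢e lt with ℕP.<-cmp x e
  ... | tri< x<e _ _ = inj₁ (ℕP.≤∧≢⇒< x<e sx≢e)
  ... | tri≈ _ x≡e _ = ⊥-elim (x≢e x≡e)
  ... | tri> _ _ e<x with ℕP.m≤n⇒m<n∨m≡n e<x
  ... | inj₂ eq = inj₂ (inj₁ (sym eq))
  ... | inj₁ se<x with ℕP.m≤n⇒m<n∨m≡n se<x
  ... | inj₂ eq = inj₂ (inj₂ (sym eq))
  ... | inj₁ sse<x = ⊥-elim (ℕP.<-irrefl refl (ℕP.<-≤-trans lt sse<x))

  sum-with-one : SumWithOne π
  sum-with-one with block e ℕP.≤-refl e≤m
  ... | i₀ , pos-i₀ = corner-entry π w F x-order y-order i₀ (turn r (pinDir e)) extreme
    where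
    F : Fin (length π) → Point
    F i = rotN r (at S (pos i))
    F-i₀ : F i₀ ≡ rotN r (at S e)
    F-i₀ = cong (λ x → rotN r (at S x)) pos-i₀
    extreme : ∀ j → j ≢ i₀ → Beyond (turn r (pinDir e)) (F i₀) (F j) × Beyond (prevD (turn r (pinDir e))) (F i₀) (F j)
    extreme j j≢i₀ with corner S (standard⇒ordered S standard) e (pos j) (subst (ℕ._< length S) pos-i₀ (pos< i₀)) (pos< j)
                          (placement (pos j) (λ eq → j≢i₀ (pos-injective j i₀ (trans eq (sym pos-i₀)))) (gap j)
                                     (ℕP.≤-<-trans (below-m j) short))
    ... | ahead , ahead-prev =
      subst (λ p → Beyond _ p (F j)) (sym F-i₀) (rotN-Beyond r _ _ _ ahead) ,
      subst (λ p → Beyond _ p (F j)) (sym F-i₀) (Beyond-resp (turn-prev r (pinDir e)) (rotN-Beyond r _ _ _ ahead-prev))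

module Subpattern (π : List ℕ) (π-unique : Unique π) (chosen : List (Fin (length π)))
  (increasing : AllPairs Fin._<_ chosen) (default : Fin (length π)) where

  value : Fin (length π) → ℕ
  value = lookup π

  below : ℕ → List (Fin (length π)) → ℕ
  below c [] = 0
  below c (j ∷ js) with value j ℕP.<? c
  ... | yes _ = suc (below c js)
  ... | no _ = below c js

  below≤length : ∀ c js → below c js ℕ.≤ length js
  below≤length c [] = z≤n
  below≤length c (j ∷ js) with value j ℕP.<? c
  ... | yes _ = s≤s (below≤length c js)
  ... | no _ = ℕP.m≤n⇒m≤1+n (below≤length c js)

  below<length : ∀ c {i} js → i ∈ js → ¬ (value i ℕ.< c) → below c js ℕ.< length js
  below<length c (j ∷ js) (here refl) not-below with value j ℕP.<? c
  ... | yes lt = ⊥-elim (not-below lt)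
  ... | no _ = s≤s (below≤length c js)
  below<length c (j ∷ js) (there i∈) not-below with value j ℕP.<? c
  ... | yes _ = s≤s (below<length c js i∈ not-below)
  ... | no _ = ℕP.m≤n⇒m≤1+n (below<length c js i∈ not-below)

  below-mono : ∀ {c c′} → c ℕ.≤ c′ → ∀ js → below c js ℕ.≤ below c′ js
  below-mono le [] = z≤n
  below-mono {c} {c′} le (j ∷ js) with value j ℕP.<? c | value j ℕP.<? c′
  ... | yes _ | yes _ = s≤s (below-mono le js)
  ... | yes lt | no nlt = ⊥-elim (nlt (ℕP.<-≤-trans lt le))
  ... | no _ | yes _ = ℕP.m≤n⇒m≤1+n (below-mono le js)
  ... | no _ | no _ = below-mono le js

  below-strict : ∀ {c c′} → c ℕ.≤ c′ → ∀ {i} js → i ∈ js → value i ℕ.< c′ → ¬ (value i ℕ.< c) →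
    below c js ℕ.< below c′ js
  below-strict {c} {c′} le (j ∷ js) (here refl) lt′ nlt with value j ℕP.<? c | value j ℕP.<? c′
  ... | yes lt | _ = ⊥-elim (nlt lt)
  ... | no _ | yes _ = s≤s (below-mono le js)
  ... | no _ | no nlt′ = ⊥-elim (nlt′ lt′)
  below-strict {c} {c′} le (j ∷ js) (there i∈) lt′ nlt with value j ℕP.<? c | value j ℕP.<? c′
  ... | yes _ | yes _ = s≤s (below-strict le js i∈ lt′ nlt)
  ... | yes lt | no nlt′ = ⊥-elim (nlt′ (ℕP.<-≤-trans lt le))
  ... | no _ | yes _ = ℕP.m≤n⇒m≤1+n (below-strict le js i∈ lt′ nlt)
  ... | no _ | no _ = below-strict le js i∈ lt′ nlt

  rank : Fin (length π) → ℕ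
  rank i = below (value i) chosen

  α : List ℕ
  α = map rank chosen

  rank-mono : ∀ {i j} → i ∈ chosen → value i ℕ.< value j → rank i ℕ.< rank j
  rank-mono i∈ lt = below-strict (ℕP.<⇒≤ lt) chosen i∈ lt (ℕP.<-irrefl refl)

  rank-order : ∀ {i j} → i ∈ chosen → j ∈ chosen → (value i ℕ.< value j) ⇔ (rank i ℕ.< rank j)
  rank-order {i} {j} i∈ j∈ = mk⇔ (rank-mono i∈) reflect
    where
    reflect : rank i ℕ.< rank j → value i ℕ.< value j
    reflect lt with ℕP.<-cmp (value i) (value j)
    ... | tri< v< _ _ = v<
    ... | tri≈ _ v≡ _ = ⊥-elim (ℕP.<-irrefl (cong rank (lookup-injective π-unique i j v≡)) lt)
    ... | tri> _ _ v> = ⊥-elim (ℕP.<-asym lt (rank-mono j∈ v>))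

  rank< : ∀ {i} → i ∈ chosen → rank i ℕ.< length chosen
  rank< i∈ = below<length _ chosen i∈ (ℕP.<-irrefl refl)

  entry : ℕ → Fin (length π)
  entry = nth default chosen

  entry∈ : ∀ p → p ℕ.< length chosen → entry p ∈ chosen
  entry∈ = nth-∈ default chosen

  entry-mono : ∀ p q → p ℕ.< q → q ℕ.< length chosen → entry p Fin.< entry q
  entry-mono = nth-AllPairs default increasing

  entry-order : ∀ p q → p ℕ.< length chosen → q ℕ.< length chosen → (entry p Fin.< entry q) ⇔ (p ℕ.< q)
  entry-order p q p< q< = mk⇔ reflect (λ lt → entry-mono p q lt q<)
    where
    reflect : entry p Fin.< entry q → p ℕ.< q
    reflect lt with ℕP.<-cmp p q
    ... | tri< p<q _ _ = p<q
    ... | tri≈ _ refl _ = ⊥-elim (ℕP.<-irrefl refl lt)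
    ... | tri> _ _ q<p = ⊥-elim (ℕP.<-asym lt (entry-mono q p q<p p<))

  entry-injective : ∀ p q → p ℕ.< length chosen → q ℕ.< length chosen → entry p ≡ entry q → p ≡ q
  entry-injective p q p< q< eq with ℕP.<-cmp p q
  ... | tri< p<q _ _ = ⊥-elim (ℕP.<-irrefl (cong toℕ eq) (entry-mono p q p<q q<))
  ... | tri≈ _ p≡q _ = p≡q
  ... | tri> _ _ q<p = ⊥-elim (ℕP.<-irrefl (cong toℕ (sym eq)) (entry-mono q p q<p p<))

  length-α : length α ≡ length chosen
  length-α = length-map rank chosen

  index< : ∀ (k : Fin (length α)) → toℕ k ℕ.< length chosen
  index< k = subst (toℕ k ℕ.<_) length-α (FinP.toℕ<n k)

  lookup-α : ∀ k → lookup α k ≡ rank (entry (toℕ k))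
  lookup-α k = trans (lookup-nth (rank default) α k) (nth-map rank default (rank default) chosen (toℕ k) (index< k))

  α-order : ∀ k k′ → (value (entry (toℕ k)) ℕ.< value (entry (toℕ k′))) ⇔ (lookup α k ℕ.< lookup α k′)
  α-order k k′ = subst₂ (λ a b → (value (entry (toℕ k)) ℕ.< value (entry (toℕ k′))) ⇔ (a ℕ.< b))
                   (sym (lookup-α k)) (sym (lookup-α k′))
    (rank-order (entry∈ _ (index< k)) (entry∈ _ (index< k′)))

  α-IsPerm : IsPerm α
  α-IsPerm = IsPerm-intro
    (AllPairsP.map⁺ (AllPairs-nth default chosen distinct))
    (subst (λ n → All (ℕ._< n) α) (sym length-α) (AllP.map⁺ (All.tabulate rank<)))
    where
    distinct : ∀ p q → p ℕ.< q → q ℕ.< length chosen → rank (entry p) ≢ rank (entry q)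
    distinct p q p<q q< eq with ℕP.<-cmp (value (entry p)) (value (entry q))
    ... | tri< lt _ _ = ℕP.<-irrefl eq (rank-mono (entry∈ p (ℕP.<-trans p<q q<)) lt)
    ... | tri≈ _ v≡ _ = ℕP.<-irrefl (cong toℕ (lookup-injective π-unique _ _ v≡)) (entry-mono p q p<q q<)
    ... | tri> _ _ gt = ℕP.<-irrefl (sym eq) (rank-mono (entry∈ q q<) gt)

  α-contained : Contained α π
  α-contained = (λ k → entry (toℕ k)) , (λ k k′ lt → entry-mono (toℕ k) (toℕ k′) lt (index< k′)) ,
    λ k k′ → ⇔.sym (α-order k k′)

sizes-equal : ∀ {a b} (u : Fin a → Fin b) → (∀ k k′ → u k ≡ u k′ → k ≡ k′) →
  (v : Fin b → Fin a) → (∀ i → u (v i) ≡ i) → a ≡ b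
sizes-equal u u-injective v uv = ℕP.≤-antisym
  (FinP.injective⇒≤ {f = u} λ {x} {y} eq → u-injective x y eq)
  (FinP.injective⇒≤ {f = v} λ {x} {y} eq → trans (sym (uv x)) (trans (cong u eq) (uv y)))

AllPairs-lookup : ∀ {R : A → A → Set} xs → (∀ k k′ → k Fin.< k′ → R (lookup xs k) (lookup xs k′)) → AllPairs R xs
AllPairs-lookup [] f = []
AllPairs-lookup (x ∷ xs) f =
  All-lookup xs (λ k → f zero (suc k) (s≤s z≤n)) ∷ AllPairs-lookup xs (λ k k′ lt → f (suc k) (suc k′) (s≤s lt))

plot-intro : ∀ (π : List ℕ) (F : Fin (length π) → Point) →
  (∀ i j → (X (F i) ℤ.< X (F j)) ⇔ (i Fin.< j)) →
  (∀ i j → (Y (F i) ℤ.< Y (F j)) ⇔ (lookup π i ℕ.< lookup π j)) →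
  Unique π → (L : List Point) → length L ≡ length π →
  (u : Fin (length L) → Fin (length π)) → (∀ k → lookup L k ≡ F (u k)) →
  (∀ k k′ → u k ≡ u k′ → k ≡ k′) → PlotOf π L
plot-intro π F x-ord y-ord π-unique L len u L≡F u-injective =
  AllPairs-lookup L (λ k k′ k<k′ →
    subst₂ (λ a b → X a ≢ X b × Y a ≢ Y b) (sym (L≡F k)) (sym (L≡F k′))
      (distinct (u k) (u k′) (λ eq → ℕP.<-irrefl (cong toℕ (u-injective k k′ eq)) k<k′))) ,
  len , u ,
  λ k k′ → subst₂ (λ a b → ((X a ℤ.< X b) ⇔ (u k Fin.< u k′)) × ((Y a ℤ.< Y b) ⇔ (lookup π (u k) ℕ.< lookup π (u k′))))
             (sym (L≡F k)) (sym (L≡F k′)) (x-ord (u k) (u k′) , y-ord (u k) (u k′))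
  where
  distinct : ∀ a b → a ≢ b → X (F a) ≢ X (F b) × Y (F a) ≢ Y (F b)
  distinct a b a≢b = x-distinct , y-distinct
    where
    x-distinct : X (F a) ≢ X (F b)
    x-distinct eq with FinP.<-cmp a b
    ... | tri< lt _ _ = ℤP.<-irrefl eq (from (x-ord a b) lt)
    ... | tri≈ _ a≡b _ = a≢b a≡b
    ... | tri> _ _ gt = ℤP.<-irrefl (sym eq) (from (x-ord b a) gt)
    y-distinct : Y (F a) ≢ Y (F b)
    y-distinct eq with ℕP.<-cmp (lookup π a) (lookup π b)
    ... | tri< lt _ _ = ℤP.<-irrefl eq (from (y-ord a b) lt)
    ... | tri≈ _ v≡ _ = a≢b (lookup-injective π-unique a b v≡)
    ... | tri> _ _ gt = ℤP.<-irrefl (sym eq) (from (y-ord b a) gt)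

-- The points
-- s_e … s_m, turned back by e quarter turns, form a standard spiral; the entries
-- played by points before s_{e-1} ("inner" entries) lie in its central box and
-- form the inserted pattern α; viewing everything after r + e quarter turns
-- recovers the original picture.

module LongRun {π : List ℕ} (w : InW π) (R : Realisation π) (L : LastRun R)
  (long : 3 ℕ.+ LastRun.e L ℕ.≤ LastRun.m L) where
  open Realisation R
  open LastRun L
  open +-*-Solver

  n : ℕ
  n = length π

  default : Fin n
  default = proj₁ (block e ℕP.≤-refl e≤m)

  F : Fin n → Point
  F i = rotN r (at S (pos i))

  -- the run has d = m + 1 - e ≥ 4 points
  d : ℕ
  d = suc (suc (suc (suc (m ∸ (3 ℕ.+ e)))))

  e+d : e ℕ.+ d ≡ suc m
  e+d = trans (solve 2 (λ e d′ → e :+ (con 4 :+ d′) := con 1 :+ ((con 3 :+ e) :+ d′)) refl e (m ∸ (3 ℕ.+ e)))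
              (cong suc (ℕP.m+[n∸m]≡n long))

  e+d≤ : e ℕ.+ d ℕ.≤ length S
  e+d≤ = subst (ℕ._≤ length S) (sym e+d) m<

  open Segment S (standard⇒ordered S standard) e

  spiral : List Point
  spiral = segment d

  turns : ℕ
  turns = r ℕ.+ e

  turns-back : ∀ p → rotN turns (rotN back p) ≡ rotN r p
  turns-back p = begin
    rotN turns (rotN back p)     ≡⟨ rotN-+ turns back p ⟩
    rotN (turns ℕ.+ back) p      ≡⟨ cong (λ k → rotN k p) (solve 2 (λ r e → (r :+ e) :+ e :* con 3 := r :+ e :* con 4) refl r e) ⟩
    rotN (r ℕ.+ e ℕ.* 4) p       ≡⟨ rotN-+ r (e ℕ.* 4) p ⟨
    rotN r (rotN (e ℕ.* 4) p)    ≡⟨ cong (rotN r) (rotN-periodic e p) ⟩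
    rotN r p                     ∎
    where open ≡-Reasoning

  Inner : Fin n → Set
  Inner i = suc (pos i) ℕ.< e

  inner? : ∀ i → Dec (Inner i)
  inner? i = suc (pos i) ℕP.<? e

  chosen : List (Fin n)
  chosen = filter inner? (allFin n)

  open Subpattern π (IsPerm⇒unique (proj₁ w)) chosen
    (AllPairsP.filter⁺ inner? (AllPairsP.tabulate⁺-< (λ lt → lt))) default

  inner⁻ : ∀ {i} → i ∈ chosen → Inner i
  inner⁻ i∈ = proj₂ (∈-filter⁻ inner? {xs = allFin n} i∈)

  inner⁺ : ∀ {i} → Inner i → i ∈ chosen
  inner⁺ inner = ∈-filter⁺ inner? (∈-allFin _) inner

  outer-in-run : ∀ i → ¬ Inner i → e ℕ.≤ pos i
  outer-in-run i not-inner with ℕP.m≤n⇒m<n∨m≡n (ℕP.≮⇒≥ not-inner)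
  ... | inj₁ lt = ℕP.≤-pred lt
  ... | inj₂ eq = ⊥-elim (gap i (sym eq))

  G : Fin n → Point
  G i = rotN back (at S (pos i))

  inserted : List Point
  inserted = map G chosen

  boxed : All (InBox spiral) inserted
  boxed = AllP.map⁺ (All.tabulate λ i∈ → early-in-box (m ∸ (3 ℕ.+ e)) (pos _) e+d≤ (inner⁻ i∈))

  α-plot : PlotOf α (map (rotN turns) inserted)
  α-plot = plot-intro α (λ k → F (entry (toℕ k))) x-ord y-ord
    (IsPerm⇒unique α-IsPerm) _ len (Fin.cast len) at-entry cast-injective
    where
    x-ord : ∀ k k′ → (X (F (entry (toℕ k))) ℤ.< X (F (entry (toℕ k′)))) ⇔ (k Fin.< k′)
    x-ord k k′ = ⇔.trans (x-order _ _) (entry-order (toℕ k) (toℕ k′) (index< k) (index< k′))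
    y-ord : ∀ k k′ → (Y (F (entry (toℕ k))) ℤ.< Y (F (entry (toℕ k′)))) ⇔ (lookup α k ℕ.< lookup α k′)
    y-ord k k′ = ⇔.trans (y-order _ _) (α-order k k′)
    len : length (map (rotN turns) inserted) ≡ length α
    len = trans (length-map (rotN turns) inserted) (trans (length-map G chosen) (sym length-α))
    at-entry : ∀ k → lookup (map (rotN turns) inserted) k ≡ F (entry (toℕ (Fin.cast len k)))
    at-entry k = begin
      lookup (map (rotN turns) inserted) k             ≡⟨ lookup-nth (0ℤ , 0ℤ) (map (rotN turns) inserted) k ⟩
      at (map (rotN turns) inserted) (toℕ k)           ≡⟨ nth-map (rotN turns) (0ℤ , 0ℤ) _ inserted (toℕ k) k< ⟩
      rotN turns (at inserted (toℕ k))                 ≡⟨ cong (rotN turns) (nth-map G default _ chosen (toℕ k) k<′) ⟩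
      rotN turns (G (entry (toℕ k)))                   ≡⟨ turns-back _ ⟩
      F (entry (toℕ k))                                ≡⟨ cong (λ p → F (entry p)) (FinP.toℕ-cast len k) ⟨
      F (entry (toℕ (Fin.cast len k)))                 ∎
      where
      open ≡-Reasoning
      k< : toℕ k ℕ.< length inserted
      k< = subst (toℕ k ℕ.<_) (length-map (rotN turns) inserted) (FinP.toℕ<n k)
      k<′ : toℕ k ℕ.< length chosen
      k<′ = subst (toℕ k ℕ.<_) (length-map G chosen) k<
    cast-injective : ∀ k k′ → Fin.cast len k ≡ Fin.cast len k′ → k ≡ k′
    cast-injective k k′ eq = FinP.toℕ-injective
      (trans (sym (FinP.toℕ-cast len k)) (trans (cong toℕ eq) (FinP.toℕ-cast len k′)))

  run-entry : ℕ → Fin n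
  run-entry y with Used? pos y
  ... | yes (i , _) = i
  ... | no _ = default

  pos-run-entry : ∀ y → e ℕ.≤ y → y ℕ.≤ m → pos (run-entry y) ≡ y
  pos-run-entry y e≤y y≤m with Used? pos y
  ... | yes (i , eq) = eq
  ... | no unused = ⊥-elim (unused (block y e≤y y≤m))

  N : ℕ
  N = d ℕ.+ length chosen

  in-run : ∀ x → x ℕ.< d → e ℕ.+ x ℕ.≤ m
  in-run x x<d = ℕP.≤-pred (subst (e ℕ.+ x ℕ.<_) e+d (ℕP.+-monoʳ-< e x<d))

  in-tail : ∀ x → x ℕ.< N → ¬ x ℕ.< d → x ∸ d ℕ.< length chosen
  in-tail x x<N x≮d = ℕP.+-cancelˡ-< d (x ∸ d) (length chosen)
    (subst (ℕ._< N) (sym (ℕP.m+[n∸m]≡n (ℕP.≮⇒≥ x≮d))) x<N)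

  entry-at : ℕ → Fin n
  entry-at x with x ℕP.<? d
  ... | yes _ = run-entry (e ℕ.+ x)
  ... | no _ = entry (x ∸ d)

  position-of : Fin n → ℕ
  position-of i with inner? i
  ... | yes inner = d ℕ.+ proj₁ (nth-index default (inner⁺ inner))
  ... | no _ = pos i ∸ e

  run-not-inner : ∀ x → x ℕ.< d → ¬ Inner (run-entry (e ℕ.+ x))
  run-not-inner x x<d inner = ℕP.<-irrefl refl (ℕP.<-≤-trans inner
    (subst (λ y → e ℕ.≤ suc y) (sym (pos-run-entry _ (ℕP.m≤m+n e x) (in-run x x<d)))
      (ℕP.≤-trans (ℕP.m≤m+n e x) (ℕP.n≤1+n _))))

  entry-at-injective : ∀ x x′ → x ℕ.< N → x′ ℕ.< N → entry-at x ≡ entry-at x′ → x ≡ x′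
  entry-at-injective x x′ x< x′< eq with x ℕP.<? d | x′ ℕP.<? d
  ... | yes x<d | yes x′<d = ℕP.+-cancelˡ-≡ e x x′
    (trans (sym (pos-run-entry _ (ℕP.m≤m+n e x) (in-run x x<d)))
      (trans (cong pos eq) (pos-run-entry _ (ℕP.m≤m+n e x′) (in-run x′ x′<d))))
  ... | yes x<d | no x′≮d = ⊥-elim (run-not-inner x x<d (subst Inner (sym eq) (inner⁻ (entry∈ _ (in-tail x′ x′< x′≮d)))))
  ... | no x≮d | yes x′<d = ⊥-elim (run-not-inner x′ x′<d (subst Inner eq (inner⁻ (entry∈ _ (in-tail x x< x≮d)))))
  ... | no x≮d | no x′≮d = begin
    x                ≡⟨ ℕP.m+[n∸m]≡n (ℕP.≮⇒≥ x≮d) ⟨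
    d ℕ.+ (x ∸ d)    ≡⟨ cong (d ℕ.+_) (entry-injective _ _ (in-tail x x< x≮d) (in-tail x′ x′< x′≮d) eq) ⟩
    d ℕ.+ (x′ ∸ d)   ≡⟨ ℕP.m+[n∸m]≡n (ℕP.≮⇒≥ x′≮d) ⟩
    x′               ∎
    where open ≡-Reasoning

  run-offset< : ∀ i → ¬ Inner i → pos i ∸ e ℕ.< d
  run-offset< i not-inner = ℕP.+-cancelˡ-< e (pos i ∸ e) d
    (subst (ℕ._< e ℕ.+ d) (sym (ℕP.m+[n∸m]≡n (outer-in-run i not-inner))) (subst (pos i ℕ.<_) (sym e+d) (s≤s (below-m i))))

  position-of< : ∀ i → position-of i ℕ.< N
  position-of< i with inner? i
  ... | yes inner = ℕP.+-monoʳ-< d (proj₁ (proj₂ (nth-index default (inner⁺ inner))))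
  ... | no not-inner = ℕP.<-≤-trans (run-offset< i not-inner) (ℕP.m≤m+n d _)

  entry-at-position : ∀ i → entry-at (position-of i) ≡ i
  entry-at-position i with inner? i
  ... | yes inner = tail-case (d ℕ.+ proj₁ (nth-index default (inner⁺ inner))) refl
    where
    tail-case : ∀ x → x ≡ d ℕ.+ proj₁ (nth-index default (inner⁺ inner)) → entry-at x ≡ i
    tail-case x x≡ with x ℕP.<? d
    ... | yes x<d = ⊥-elim (ℕP.<-irrefl refl (ℕP.<-≤-trans x<d (subst (d ℕ.≤_) (sym x≡) (ℕP.m≤m+n d _))))
    ... | no _ = trans (cong entry (trans (cong (_∸ d) x≡) (ℕP.m+n∸m≡n d _)))
                       (proj₂ (proj₂ (nth-index default (inner⁺ inner))))
  ... | no not-inner = run-case (pos i ∸ e) refl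
    where
    run-case : ∀ x → x ≡ pos i ∸ e → entry-at x ≡ i
    run-case x x≡ with x ℕP.<? d
    ... | yes x<d = pos-injective _ _ (trans (pos-run-entry (e ℕ.+ x) (ℕP.m≤m+n e x) (in-run x x<d))
                      (trans (cong (e ℕ.+_) x≡) (ℕP.m+[n∸m]≡n (outer-in-run i not-inner))))
    ... | no x≮d = ⊥-elim (x≮d (subst (ℕ._< d) (sym x≡) (run-offset< i not-inner)))

  points : List Point
  points = map (rotN turns) (spiral ++ inserted)

  length-spiral : length spiral ≡ d
  length-spiral = length-applyUpTo point d

  length-joined : length (spiral ++ inserted) ≡ N
  length-joined = trans (length-++ spiral) (cong₂ ℕ._+_ length-spiral (length-map G chosen))

  length-points : length points ≡ N
  length-points = trans (length-map (rotN turns) (spiral ++ inserted)) length-joined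

  point-at : ∀ x → x ℕ.< N → at points x ≡ F (entry-at x)
  point-at x x<N = trans (nth-map (rotN turns) (0ℤ , 0ℤ) _ (spiral ++ inserted) x
                           (subst (x ℕ.<_) (sym length-joined) x<N))
                         (unturned x x<N)
    where
    unturned : ∀ x → x ℕ.< N → rotN turns (at (spiral ++ inserted) x) ≡ F (entry-at x)
    unturned x x<N with x ℕP.<? d
    ... | yes x<d = begin
      rotN turns (at (spiral ++ inserted) x)   ≡⟨ cong (rotN turns) (nth-++ˡ _ spiral inserted x (subst (x ℕ.<_) (sym length-spiral) x<d)) ⟩
      rotN turns (at spiral x)                 ≡⟨ cong (rotN turns) (nth-applyUpTo _ point d x x<d) ⟩
      rotN turns (point x)                     ≡⟨ turns-back _ ⟩
      rotN r (at S (e ℕ.+ x))                  ≡⟨ cong (λ y → rotN r (at S y)) (pos-run-entry (e ℕ.+ x) (ℕP.m≤m+n e x) (in-run x x<d)) ⟨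
      F (run-entry (e ℕ.+ x))                  ∎
      where open ≡-Reasoning
    ... | no x≮d = begin
      rotN turns (at (spiral ++ inserted) x)                        ≡⟨ cong (λ y → rotN turns (at (spiral ++ inserted) y)) x≡ ⟨
      rotN turns (at (spiral ++ inserted) (length spiral ℕ.+ (x ∸ d))) ≡⟨ cong (rotN turns) (nth-++ʳ _ spiral inserted (x ∸ d)) ⟩
      rotN turns (at inserted (x ∸ d))                              ≡⟨ cong (rotN turns) (nth-map G default _ chosen (x ∸ d) (in-tail x x<N x≮d)) ⟩
      rotN turns (G (entry (x ∸ d)))                                ≡⟨ turns-back _ ⟩
      F (entry (x ∸ d))                                             ∎
      where
      open ≡-Reasoning
      x≡ : length spiral ℕ.+ (x ∸ d) ≡ x
      x≡ = trans (cong (ℕ._+ (x ∸ d)) length-spiral) (ℕP.m+[n∸m]≡n (ℕP.≮⇒≥ x≮d))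

  π-plot : PlotOf π points
  π-plot = plot-intro π F x-order y-order (IsPerm⇒unique (proj₁ w)) points len u
    (λ k → trans (lookup-nth (0ℤ , 0ℤ) points k) (point-at (toℕ k) (k< k))) u-injective
    where
    k< : ∀ (k : Fin (length points)) → toℕ k ℕ.< N
    k< k = subst (toℕ k ℕ.<_) length-points (FinP.toℕ<n k)
    u : Fin (length points) → Fin n
    u k = entry-at (toℕ k)
    u-injective : ∀ k k′ → u k ≡ u k′ → k ≡ k′
    u-injective k k′ eq = FinP.toℕ-injective (entry-at-injective _ _ (k< k) (k< k′) eq)
    v : Fin n → Fin (length points)
    v i = fromℕ< (subst (position-of i ℕ.<_) (sym length-points) (position-of< i))
    len : length points ≡ n
    len = sizes-equal u u-injective v λ i →
      trans (cong entry-at (FinP.toℕ-fromℕ< (subst (position-of i ℕ.<_) (sym length-points) (position-of< i))))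
            (entry-at-position i)

  central-insertion : Σ (List ℕ) λ α → InW α × CentralInsertion α π
  central-insertion = α , InW-closed α w α-IsPerm α-contained ,
           turns , spiral , inserted , segment-standard (m ∸ (3 ℕ.+ e)) e+d≤ , boxed , α-plot , π-plot

proposition4 : (π : List ℕ) → InW π → π ≢ [] →
    (Σ (List ℕ) λ α → InW α ×
       (π ≡ one ⊕ α ⊎ π ≡ α ⊕ one ⊎ π ≡ one ⊖ α ⊎ π ≡ α ⊖ one))
    ⊎ (Σ (List ℕ) λ α → InW α × CentralInsertion α π)
proposition4 [] _ π≢[] = ⊥-elim (π≢[] refl)
proposition4 π@(_ ∷ _) w _ with realise π w
... | R with last-run R
... | L with LastRun.m L ℕP.<? 3 ℕ.+ LastRun.e L
... | yes short = inj₁ (ShortRun.sum-with-one w R L short)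
... | no long = inj₂ (LongRun.central-insertion w R L (ℕP.≮⇒≥ long))
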